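{- For every integer $n>1$, \[ a(n)=\frac{n}{n-\varphi(n)}+\sum_{\substack{d\mid n\\ d\neq 1}}\frac{\varphi\left(\frac{n}{d}\right)a\left(\frac{n}{d}\right)}{n-\varphi(n)} =\frac{1}{n-\varphi(n)}\left(n+\sum_{\substack{d\mid n\\ d\neq n}}\varphi(d)\,a(d)\right), \] where $\varphi$ is Euler's totient function.
   Context: For a positive integer $n$, consider the random walk on $\mathbb{Z}/n\mathbb{Z}$ that starts at the residue $1 \pmod n$ and at each step multiplies the current state by a residue chosen uniformly at random from $\mathbb{Z}/n\mathbb{Z}$, independently of previous choices. The state $0\pmod n$ is absorbing. $a(n)$ denotes the expected number of steps until the walk first reaches $0 \pmod n$ (so $a(1)=0$). -}

module Defs where

open import Data.Bool using (Bool; true; false; not; _∧_; if_then_else_)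
open import Data.Nat as ℕ using (ℕ; zero; suc; _≡ᵇ_; _%_; _^_; NonZero; _≤_)
open import Data.Nat.Properties using (m^n≢0)
open import Data.Nat.GCD using (gcd)
open import Data.Nat.Divisibility using (_∣?_)
open import Data.Fin using (Fin; toℕ)
open import Data.Vec using (Vec; []; _∷_)
open import Data.List using (List; []; _∷_; [_]; map; concatMap; allFin; upTo)
open import Data.Integer using (+_)
open import Data.Rational using (ℚ; _/_; _+_; _*_; _-_; ∣_∣; _<_; 0ℚ)
open import Data.Product using (∃)
open import Relation.Nullary.Decidable using (⌊_⌋)

-- The random walk on ℤ/nℤ (n ≥ 1, residues represented by 0,…,n-1).
-- Start at 1 mod n; at each step multiply by a uniformly random residue
-- r ∈ Fin n. State 0 is absorbing. T = first time the walk is at 0.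

module Walk (n : ℕ) .{{_ : NonZero n}} where

  step : ℕ → Fin n → ℕ
  step x r = (x ℕ.* toℕ r) % n

  -- starting from state x, following the multipliers rs (of length k),
  -- the walk is at 0 at time k and was not at 0 at any time < k,
  -- i.e. the hitting time T equals k.
  hitsExactly : ∀ {k} → ℕ → Vec (Fin n) k → Bool
  hitsExactly x []       = x ≡ᵇ 0
  hitsExactly x (r ∷ rs) = not (x ≡ᵇ 0) ∧ hitsExactly (step x r) rs

  allVecs : (k : ℕ) → List (Vec (Fin n) k)
  allVecs zero    = [ [] ]
  allVecs (suc k) = concatMap (λ r → map (r ∷_) (allVecs k)) (allFin n)

  countTrue : ∀ {A : Set} → (A → Bool) → List A → ℕ
  countTrue p []       = 0
  countTrue p (x ∷ xs) = if p x then suc (countTrue p xs) else countTrue p xs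

  hitCount : ℕ → ℕ
  hitCount k = countTrue (hitsExactly (1 % n)) (allVecs k)

  -- P(T = k) = hitCount k / n^k   (uniform measure on (ℤ/nℤ)^k)
  probHitAt : ℕ → ℚ
  probHitAt k = _/_ (+ hitCount k) (n ^ k) {{m^n≢0 n k}}

  partialExpectation : ℕ → ℚ
  partialExpectation zero    = 0ℚ
  partialExpectation (suc K) =
    partialExpectation K + ((+ suc K) / 1) * probHitAt (suc K)

  -- q is the expected hitting time E[T] = Σ_{k≥0} k · P(T = k):
  -- the partial sums converge to q (ε–N convergence in ℚ).
  IsExpectedHittingTime : ℚ → Set
  IsExpectedHittingTime q =
    ∀ (ε : ℚ) → 0ℚ < ε →
      ∃ λ N → ∀ K → N ≤ K → ∣ partialExpectation K - q ∣ < ε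

open Walk public using (IsExpectedHittingTime)

-- Euler's totient: φ n = #{ k ∈ {1,…,n} : gcd k n = 1 }  (φ 1 = 1, φ 0 = 0).

count≤ : (ℕ → Bool) → ℕ → ℕ
count≤ p zero    = 0
count≤ p (suc k) = if p (suc k) then suc (count≤ p k) else count≤ p k

φ : ℕ → ℕ
φ n = count≤ (λ k → gcd k n ≡ᵇ 1) n

divisorSum : (n : ℕ) → (ℕ → Bool) → (ℕ → ℕ → ℚ) → ℚ
divisorSum n P f = go n
  where
  go : ℕ → ℚ
  go zero    = 0ℚ
  go (suc d) = if ⌊ suc d ∣? n ⌋ ∧ P (suc d) then f (suc d) (n ℕ./ suc d) + go d else go d

ℕ→ℚ : ℕ → ℚ
ℕ→ℚ m = (+ m) / 1

{-# OPTIONS --safe #-}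
-- Condition on the first step.  From 1 the walk jumps to a uniform residue r, and from r it
-- behaves like the walk on ℤ/(n/g) started at 1, scaled by g = gcd r n; since exactly φ d
-- residues have n / gcd r n = d, the hitting time T satisfies
--   n · P_n(T = k+1) = Σ_{d ∣ n} φ(d) · P_d(T = k).
-- Weighting by k+1 and summing gives the same kind of recurrence for the partial sums of
-- E[T], with an extra term Σ_{d ∣ n} φ(d) P_d(T ≤ K).  That term tends to Σ_{d ∣ n} φ(d) = n,
-- because the survival probability satisfies P_d(T > K) ≤ d/(d+K); so in the limit
--   n · a(n) = n + Σ_{d ∣ n} φ(d) a(d),
-- and the two formulas come from separating the divisor d = n, before or after d ↦ n/d.
module Submission where

module DivisorSums where

  open import Algebra.Bundles using (CommutativeSemiring)
  open import Data.Bool using (Bool; true; false; not; if_then_else_)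
  open import Data.Empty using (⊥-elim)
  open import Function using (it; mk⇔)
  import Data.Nat as ℕ
  open import Data.Nat using (ℕ; zero; suc; NonZero; _<_; z≤n; s≤s; _≡ᵇ_)
  open import Data.Nat.Properties as ℕₚ using (_≟_)
  open import Data.Nat.DivMod using (_/_; m*[n/m]≡n; m*n/n≡m)
  open import Data.Nat.Divisibility using (_∣_; _∣?_; ∣⇒≤; divides)
  open import Relation.Nullary using (Dec; yes; no)
  open import Relation.Nullary.Decidable using (dec-true; dec-false; does-⇔)
  open import Relation.Binary.PropositionalEquality as ≡ using (_≡_; _≢_)

  nonZero-factorˡ : ∀ m n {o} .{{_ : NonZero o}} → m ℕ.* n ≡ o → NonZero m
  nonZero-factorˡ m n mn≡o = ℕₚ.m*n≢0⇒m≢0 m {{≡.subst NonZero (≡.sym mn≡o) it}}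

  nonZero-factorʳ : ∀ m n {o} .{{_ : NonZero o}} → m ℕ.* n ≡ o → NonZero n
  nonZero-factorʳ m n mn≡o = ℕₚ.m*n≢0⇒n≢0 m {{≡.subst NonZero (≡.sym mn≡o) it}}

  cofactor-swap : ∀ {n} d e d′ e′ .{{_ : NonZero n}} → d ℕ.* e ≡ n → d′ ℕ.* e′ ≡ n →
                  (d′ ≡ᵇ e) ≡ (d ≡ᵇ e′)
  cofactor-swap {n} d e d′ e′ de≡n d′e′≡n =
    does-⇔ (mk⇔ (swap de≡n d′e′≡n) (swap d′e′≡n de≡n)) (d′ ≟ e) (d ≟ e′)
    where
    swap : ∀ {d e d′ e′} → d ℕ.* e ≡ n → d′ ℕ.* e′ ≡ n → d′ ≡ e → d ≡ e′
    swap {d} {e} {d′} {e′} de≡n d′e′≡n ≡.refl = ℕₚ.*-cancelʳ-≡ d e′ e {{e≢0}}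
      (≡.trans de≡n (≡.trans (≡.sym d′e′≡n) (ℕₚ.*-comm d′ e′)))
      where e≢0 = nonZero-factorʳ d e de≡n

  module FiniteSums {c ℓ} (R : CommutativeSemiring c ℓ) where

    open CommutativeSemiring R
    open import Relation.Binary.Reasoning.Setoid setoid

    Σ< : ℕ → (ℕ → Carrier) → Carrier
    Σ< zero    f = 0#
    Σ< (suc n) f = f 0 + Σ< n (λ i → f (suc i))

    Σ<-cong : ∀ n {f g} → (∀ i → i < n → f i ≈ g i) → Σ< n f ≈ Σ< n g
    Σ<-cong zero    f≈g = refl
    Σ<-cong (suc n) f≈g = +-cong (f≈g 0 (s≤s z≤n)) (Σ<-cong n (λ i i<n → f≈g (suc i) (s≤s i<n)))

    Σ<-zero : ∀ n {f} → (∀ i → i < n → f i ≈ 0#) → Σ< n f ≈ 0#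
    Σ<-zero zero    f≈0 = refl
    Σ<-zero (suc n) f≈0 =
      trans (+-cong (f≈0 0 (s≤s z≤n)) (Σ<-zero n (λ i i<n → f≈0 (suc i) (s≤s i<n)))) (+-identityˡ 0#)

    Σ<-+ : ∀ n (f g : ℕ → Carrier) → Σ< n (λ i → f i + g i) ≈ Σ< n f + Σ< n g
    Σ<-+ zero    f g = sym (+-identityˡ 0#)
    Σ<-+ (suc n) f g = begin
      (f 0 + g 0) + Σ< n (λ i → f (suc i) + g (suc i))  ≈⟨ +-congˡ (Σ<-+ n _ _) ⟩
      (f 0 + g 0) + (Σ< n (λ i → f (suc i)) + Σ< n (λ i → g (suc i)))
        ≈⟨ +-assoc (f 0) (g 0) _ ⟩
      f 0 + (g 0 + (Σ< n (λ i → f (suc i)) + Σ< n (λ i → g (suc i))))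
        ≈⟨ +-congˡ (x+[y+z]≈y+[x+z] (g 0) _ _) ⟩
      f 0 + (Σ< n (λ i → f (suc i)) + (g 0 + Σ< n (λ i → g (suc i))))
        ≈⟨ +-assoc (f 0) _ _ ⟨
      (f 0 + Σ< n (λ i → f (suc i))) + (g 0 + Σ< n (λ i → g (suc i))) ∎
      where
      x+[y+z]≈y+[x+z] : ∀ x y z → x + (y + z) ≈ y + (x + z)
      x+[y+z]≈y+[x+z] x y z =
        trans (sym (+-assoc x y z)) (trans (+-congʳ (+-comm x y)) (+-assoc y x z))

    Σ<-*ˡ : ∀ n x (f : ℕ → Carrier) → x * Σ< n f ≈ Σ< n (λ i → x * f i)
    Σ<-*ˡ zero    x f = zeroʳ x
    Σ<-*ˡ (suc n) x f = trans (distribˡ x _ _) (+-congˡ (Σ<-*ˡ n x _))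

    Σ<-swap : ∀ m n (f : ℕ → ℕ → Carrier) →
              Σ< m (λ i → Σ< n (f i)) ≈ Σ< n (λ j → Σ< m (λ i → f i j))
    Σ<-swap zero    n f = sym (Σ<-zero n (λ _ _ → refl))
    Σ<-swap (suc m) n f =
      trans (+-congˡ (Σ<-swap m n (λ i → f (suc i)))) (sym (Σ<-+ n (f 0) _))

    Σ<-++ : ∀ m n (f : ℕ → Carrier) → Σ< (m ℕ.+ n) f ≈ Σ< m f + Σ< n (λ i → f (m ℕ.+ i))
    Σ<-++ zero    n f = sym (+-identityˡ _)
    Σ<-++ (suc m) n f = trans (+-congˡ (Σ<-++ m n (λ i → f (suc i)))) (sym (+-assoc _ _ _))

    Σ<-snoc : ∀ n (f : ℕ → Carrier) → Σ< (suc n) f ≈ Σ< n f + f n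
    Σ<-snoc zero    f = trans (+-identityʳ _) (sym (+-identityˡ _))
    Σ<-snoc (suc n) f = trans (+-congˡ (Σ<-snoc n (λ i → f (suc i)))) (sym (+-assoc _ _ _))

    Σ<-blocks : ∀ m n (f : ℕ → Carrier) → Σ< (m ℕ.* n) f ≈ Σ< m (λ i → Σ< n (λ j → f (i ℕ.* n ℕ.+ j)))
    Σ<-blocks zero    n f = refl
    Σ<-blocks (suc m) n f = trans (Σ<-++ n (m ℕ.* n) f) (+-congˡ (trans (Σ<-blocks m n (λ r → f (n ℕ.+ r)))
      (Σ<-cong m (λ i _ → Σ<-cong n (λ j _ → reflexive (≡.cong f (≡.sym (ℕₚ.+-assoc n (i ℕ.* n) j))))))))

    Σ<-single : ∀ n c (f : ℕ → Carrier) → c < n → (∀ i → i < n → i ≢ c → f i ≈ 0#) → Σ< n f ≈ f c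
    Σ<-single (suc n) zero f _ f≈0 =
      trans (+-congˡ (Σ<-zero n (λ i i<n → f≈0 (suc i) (s≤s i<n) (λ ())))) (+-identityʳ _)
    Σ<-single (suc n) (suc c) f (s≤s c<n) f≈0 =
      trans (+-congʳ (f≈0 0 (s≤s z≤n) (λ ()))) (trans (+-identityˡ _)
        (Σ<-single n c (λ i → f (suc i)) c<n
          (λ i i<n i≢c → f≈0 (suc i) (s≤s i<n) (λ e → i≢c (ℕₚ.suc-injective e)))))

    when : Bool → Carrier → Carrier
    when b x = if b then x else 0#

    when-split : ∀ b x → x ≈ when b x + when (not b) x
    when-split true  x = sym (+-identityʳ x)
    when-split false x = sym (+-identityˡ x)

    when-*ˡ : ∀ b x y → x * when b y ≈ when b (x * y)
    when-*ˡ true  x y = refl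
    when-*ˡ false x y = zeroʳ x

    when-as-* : ∀ b x → when b x ≈ x * when b 1#
    when-as-* true  x = sym (*-identityʳ x)
    when-as-* false x = sym (zeroʳ x)

    when-Σ< : ∀ b m (f : ℕ → Carrier) → when b (Σ< m f) ≈ Σ< m (λ j → when b (f j))
    when-Σ< true  m f = refl
    when-Σ< false m f = sym (Σ<-zero m (λ _ _ → refl))

    -- Taking the divisibility test as an argument keeps Σ∣ n F neutral in F, so that
    -- unification recovers F from Σ∣ n F.
    onDivisor : (n i : ℕ) → Dec (suc i ∣ n) → (ℕ → ℕ → Carrier) → Carrier
    onDivisor n i (yes _) F = F (suc i) (n / suc i)
    onDivisor n i (no  _) F = 0#

    Σ∣ : ℕ → (ℕ → ℕ → Carrier) → Carrier
    Σ∣ n F = Σ< n (λ i → onDivisor n i (suc i ∣? n) F)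

    Σ∣-cong : ∀ n {F G} → (∀ d e → d ℕ.* e ≡ n → F d e ≈ G d e) → Σ∣ n F ≈ Σ∣ n G
    Σ∣-cong n {F} {G} F≈G = Σ<-cong n (λ i _ → term (suc i ∣? n))
      where
      term : ∀ {i} (i? : Dec (suc i ∣ n)) → onDivisor n i i? F ≈ onDivisor n i i? G
      term (yes i+1∣n) = F≈G _ _ (m*[n/m]≡n i+1∣n)
      term (no  _)     = refl

    Σ∣-+ : ∀ n (F G : ℕ → ℕ → Carrier) → Σ∣ n (λ d e → F d e + G d e) ≈ Σ∣ n F + Σ∣ n G
    Σ∣-+ n F G = trans (Σ<-cong n (λ i _ → term (suc i ∣? n))) (Σ<-+ n _ _)
      where
      term : ∀ {i} (i? : Dec (suc i ∣ n)) →
             onDivisor n i i? (λ d e → F d e + G d e) ≈ onDivisor n i i? F + onDivisor n i i? G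
      term (yes _) = refl
      term (no  _) = sym (+-identityˡ 0#)

    Σ∣-*ˡ : ∀ n x (F : ℕ → ℕ → Carrier) → x * Σ∣ n F ≈ Σ∣ n (λ d e → x * F d e)
    Σ∣-*ˡ n x F = trans (Σ<-*ˡ n x _) (Σ<-cong n (λ i _ → term (suc i ∣? n)))
      where
      term : ∀ {i} (i? : Dec (suc i ∣ n)) → x * onDivisor n i i? F ≈ onDivisor n i i? (λ d e → x * F d e)
      term (yes _) = refl
      term (no  _) = zeroʳ x

    Σ<-Σ∣-swap : ∀ m n (G : ℕ → ℕ → ℕ → Carrier) →
                 Σ< m (λ r → Σ∣ n (G r)) ≈ Σ∣ n (λ d e → Σ< m (λ r → G r d e))
    Σ<-Σ∣-swap m n G = trans (Σ<-swap m n _) (Σ<-cong n (λ i _ → term (suc i ∣? n)))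
      where
      term : ∀ {i} (i? : Dec (suc i ∣ n)) →
             Σ< m (λ r → onDivisor n i i? (G r)) ≈ onDivisor n i i? (λ d e → Σ< m (λ r → G r d e))
      term (yes _) = refl
      term (no  _) = Σ<-zero m (λ _ _ → refl)

    Σ∣-swap : ∀ m n (H : ℕ → ℕ → ℕ → ℕ → Carrier) →
              Σ∣ m (λ d e → Σ∣ n (H d e)) ≈ Σ∣ n (λ d′ e′ → Σ∣ m (λ d e → H d e d′ e′))
    Σ∣-swap m n H = trans (Σ<-cong m (λ i _ → term (suc i ∣? m))) (Σ<-Σ∣-swap m n _)
      where
      term : ∀ {i} (i? : Dec (suc i ∣ m)) →
             onDivisor m i i? (λ d e → Σ∣ n (H d e)) ≈ Σ∣ n (λ d′ e′ → onDivisor m i i? (λ d e → H d e d′ e′))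
      term (yes _) = refl
      term (no  _) = sym (Σ<-zero n (λ j _ → term′ (suc j ∣? n)))
        where
        term′ : ∀ {j} (j? : Dec (suc j ∣ n)) → onDivisor n j j? (λ _ _ → 0#) ≈ 0#
        term′ (yes _) = refl
        term′ (no  _) = refl

    Σ∣-single : ∀ n .{{_ : NonZero n}} x y (G : ℕ → ℕ → Carrier) → x ℕ.* y ≡ n →
                Σ∣ n (λ d e → when (d ≡ᵇ x) (G d e)) ≈ G x y
    Σ∣-single n zero y G ≡.refl = ⊥-elim (ℕ.≢-nonZero⁻¹ n ≡.refl)
    Σ∣-single n (suc c) y G xy≡n = trans (Σ<-single n c _ c<n (λ i _ i≢c → off-c i≢c (suc i ∣? n))) (at-c (suc c ∣? n))
      where
      x∣n : suc c ∣ n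
      x∣n = divides y (≡.trans (≡.sym xy≡n) (ℕₚ.*-comm (suc c) y))
      c<n : c < n
      c<n = ∣⇒≤ x∣n
      n/x≡y : n / suc c ≡ y
      n/x≡y = ≡.trans (≡.cong (_/ suc c) (≡.trans (≡.sym xy≡n) (ℕₚ.*-comm (suc c) y))) (m*n/n≡m y (suc c))
      off-c : ∀ {i} → i ≢ c → (i? : Dec (suc i ∣ n)) → onDivisor n i i? (λ d e → when (d ≡ᵇ suc c) (G d e)) ≈ 0#
      off-c {i} i≢c (yes _) rewrite dec-false (i ≟ c) i≢c = refl
      off-c     i≢c (no  _) = refl
      at-c : (c? : Dec (suc c ∣ n)) → onDivisor n c c? (λ d e → when (d ≡ᵇ suc c) (G d e)) ≈ G (suc c) y
      at-c (yes _) rewrite dec-true (c ≟ c) ≡.refl = reflexive (≡.cong (G (suc c)) n/x≡y)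
      at-c (no  ¬x∣n) = ⊥-elim (¬x∣n x∣n)

    Σ∣-remove : ∀ n .{{_ : NonZero n}} x y (F : ℕ → ℕ → Carrier) → x ℕ.* y ≡ n →
                Σ∣ n F ≈ F x y + Σ∣ n (λ d e → when (not (d ≡ᵇ x)) (F d e))
    Σ∣-remove n x y F xy≡n = begin
      Σ∣ n F
        ≈⟨ Σ∣-cong n (λ d e _ → when-split (d ≡ᵇ x) (F d e)) ⟩
      Σ∣ n (λ d e → when (d ≡ᵇ x) (F d e) + when (not (d ≡ᵇ x)) (F d e))
        ≈⟨ Σ∣-+ n _ _ ⟩
      Σ∣ n (λ d e → when (d ≡ᵇ x) (F d e)) + Σ∣ n (λ d e → when (not (d ≡ᵇ x)) (F d e))
        ≈⟨ +-congʳ (Σ∣-single n x y F xy≡n) ⟩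
      F x y + Σ∣ n (λ d e → when (not (d ≡ᵇ x)) (F d e)) ∎

    Σ∣-involution : ∀ n .{{_ : NonZero n}} (F : ℕ → ℕ → Carrier) → Σ∣ n (λ d e → F e d) ≈ Σ∣ n F
    Σ∣-involution n F = begin
      Σ∣ n (λ d e → F e d)
        ≈⟨ Σ∣-cong n (λ d e de≡n → sym (Σ∣-single n e d F (≡.trans (ℕₚ.*-comm e d) de≡n))) ⟩
      Σ∣ n (λ d e → Σ∣ n (λ d′ e′ → when (d′ ≡ᵇ e) (F d′ e′)))
        ≈⟨ Σ∣-swap n n _ ⟩
      Σ∣ n (λ d′ e′ → Σ∣ n (λ d e → when (d′ ≡ᵇ e) (F d′ e′)))
        ≈⟨ Σ∣-cong n (λ d′ e′ d′e′≡n → trans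
             (Σ∣-cong n (λ d e de≡n →
             reflexive (≡.cong (λ b → when b (F d′ e′)) (cofactor-swap d e d′ e′ de≡n d′e′≡n))))
             (Σ∣-single n e′ d′ (λ _ _ → F d′ e′) (≡.trans (ℕₚ.*-comm e′ d′) d′e′≡n))) ⟩
      Σ∣ n F ∎

    Σ<-fibres : ∀ m n (q : ℕ → ℕ) (F : ℕ → ℕ → Carrier) →
                Σ< m (λ r → Σ∣ n (λ d e → when (d ≡ᵇ q r) (F d e)))
                ≈ Σ∣ n (λ d e → F d e * Σ< m (λ r → when (d ≡ᵇ q r) 1#))
    Σ<-fibres m n q F = trans (Σ<-Σ∣-swap m n _) (Σ∣-cong n (λ d e _ →
      trans (Σ<-cong m (λ r _ → when-as-* _ (F d e))) (sym (Σ<-*ˡ m (F d e) _))))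

module Totient where

  open import Defs using (φ; count≤)
  open DivisorSums
  open import Data.Bool using (true; false; if_then_else_)
  open import Data.Nat
  open import Data.Nat.Properties
  open import Data.Nat.DivMod using (m*[n/m]≡n)
  open import Data.Nat.Divisibility
    using (_∣_; n∣m*n; ∣m+n∣m⇒∣n; ∣⇒≤; ∣-antisym; ∣-refl)
  open import Data.Nat.GCD
    using (gcd; gcd[m,n]∣m; gcd[m,n]∣n; gcd[m,n]≢0; gcd-greatest; gcd-identityˡ; c*gcd[m,n]≡gcd[cm,cn])
  open import Data.Sum using (inj₂)
  open import Function using (mk⇔)
  open import Relation.Nullary.Decidable using (does-⇔; dec-false)
  open import Relation.Binary.PropositionalEquality
  open ≡-Reasoning

  open FiniteSums +-*-commutativeSemiring public

  gcd-nonZero : ∀ m n .{{_ : NonZero n}} → NonZero (gcd m n)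
  gcd-nonZero m n = ≢-nonZero (gcd[m,n]≢0 m n (inj₂ (≢-nonZero⁻¹ n)))

  count≤-Σ< : ∀ p k → count≤ p k ≡ Σ< k (λ i → when (p (suc i)) 1)
  count≤-Σ< p zero    = refl
  count≤-Σ< p (suc k) = trans (last (p (suc k))) (sym (Σ<-snoc k (λ i → when (p (suc i)) 1)))
    where
    last : ∀ b → (if b then suc (count≤ p k) else count≤ p k) ≡ Σ< k (λ i → when (p (suc i)) 1) + when b 1
    last true  = trans (cong suc (count≤-Σ< p k)) (+-comm 1 _)
    last false = trans (count≤-Σ< p k) (sym (+-identityʳ _))

  -- φ counts 1 ≤ r ≤ m, Σ< counts 0 ≤ r < m; the end points agree since gcd 0 m = m = gcd m m.
  φ-Σ< : ∀ m → φ m ≡ Σ< m (λ r → when (gcd r m ≡ᵇ 1) 1)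
  φ-Σ< zero    = refl
  φ-Σ< (suc m) = begin
    φ (suc m)                                    ≡⟨ count≤-Σ< _ (suc m) ⟩
    Σ< (suc m) (λ i → coprime (suc i))           ≡⟨ Σ<-snoc m (λ i → coprime (suc i)) ⟩
    Σ< m (λ i → coprime (suc i)) + coprime (suc m)
      ≡⟨ cong (λ g → Σ< m (λ i → coprime (suc i)) + when (g ≡ᵇ 1) 1) (sym gcd[0,m]≡gcd[m,m]) ⟩
    Σ< m (λ i → coprime (suc i)) + coprime 0     ≡⟨ +-comm _ (coprime 0) ⟩
    Σ< (suc m) coprime                           ∎
    where
    coprime : ℕ → ℕ
    coprime r = when (gcd r (suc m) ≡ᵇ 1) 1
    gcd[0,m]≡gcd[m,m] : gcd 0 (suc m) ≡ gcd (suc m) (suc m)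
    gcd[0,m]≡gcd[m,m] = trans (gcd-identityˡ (suc m))
      (∣-antisym (gcd-greatest ∣-refl ∣-refl) (gcd[m,n]∣m (suc m) (suc m)))

  gcd-class-size : ∀ {n} g e .{{_ : NonZero g}} → g * e ≡ n →
                   Σ< n (λ r → when (g ≡ᵇ gcd r n) 1) ≡ φ e
  gcd-class-size {n} g e ge≡n = begin
    Σ< n (λ r → when (g ≡ᵇ gcd r n) 1)
      ≡⟨ cong (λ m → Σ< m (λ r → when (g ≡ᵇ gcd r n) 1)) n≡e*g ⟩
    Σ< (e * g) (λ r → when (g ≡ᵇ gcd r n) 1)
      ≡⟨ Σ<-blocks e g _ ⟩
    Σ< e (λ y → Σ< g (λ j → when (g ≡ᵇ gcd (y * g + j) n) 1))
      ≡⟨ Σ<-cong e (λ y _ → block y) ⟩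
    Σ< e (λ y → when (gcd y e ≡ᵇ 1) 1)
      ≡⟨ φ-Σ< e ⟨
    φ e ∎
    where
    n≡e*g : n ≡ e * g
    n≡e*g = trans (sym ge≡n) (*-comm g e)
    gcd[yg,n]≡g*gcd[y,e] : ∀ y → gcd (y * g + 0) n ≡ g * gcd y e
    gcd[yg,n]≡g*gcd[y,e] y = sym (trans (c*gcd[m,n]≡gcd[cm,cn] g y e)
      (cong₂ gcd (trans (*-comm g y) (sym (+-identityʳ _))) ge≡n))
    -- In the block of y only y * g itself can have gcd g with n, and it does iff y ⊥ e.
    block : ∀ y → Σ< g (λ j → when (g ≡ᵇ gcd (y * g + j) n) 1) ≡ when (gcd y e ≡ᵇ 1) 1
    block y = trans (Σ<-single g 0 _ (>-nonZero⁻¹ g) off-0)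
                    (cong (λ b → when b 1) (does-⇔ (mk⇔ to from) (g ≟ _) (gcd y e ≟ 1)))
      where
      to : g ≡ gcd (y * g + 0) n → gcd y e ≡ 1
      to eq = *-cancelˡ-≡ (gcd y e) 1 g (trans (sym (trans eq (gcd[yg,n]≡g*gcd[y,e] y))) (sym (*-identityʳ g)))
      from : gcd y e ≡ 1 → g ≡ gcd (y * g + 0) n
      from eq = sym (trans (gcd[yg,n]≡g*gcd[y,e] y) (trans (cong (g *_) eq) (*-identityʳ g)))
      off-0 : ∀ j → j < g → j ≢ 0 → when (g ≡ᵇ gcd (y * g + j) n) 1 ≡ 0
      off-0 j j<g j≢0 = cong (λ b → when b 1) (dec-false (g ≟ _) g≢gcd)
        where
        g≢gcd : g ≢ gcd (y * g + j) n
        g≢gcd eq = <⇒≱ j<g (∣⇒≤ {{≢-nonZero j≢0}} (∣m+n∣m⇒∣n g∣yg+j (n∣m*n y)))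
          where g∣yg+j = subst (_∣ y * g + j) (sym eq) (gcd[m,n]∣m (y * g + j) n)

  Σ<-const : ∀ n c → Σ< n (λ _ → c) ≡ n * c
  Σ<-const zero    c = refl
  Σ<-const (suc n) c = cong (c +_) (Σ<-const n c)

  Σ<-by-gcd : ∀ n .{{_ : NonZero n}} (F : ℕ → ℕ → ℕ) →
              Σ< n (λ r → Σ∣ n (λ d e → when (d ≡ᵇ gcd r n) (F d e))) ≡ Σ∣ n (λ d e → F d e * φ e)
  Σ<-by-gcd n F = trans (Σ<-fibres n n (λ r → gcd r n) F)
    (Σ∣-cong n (λ d e de≡n → cong (F d e *_) (gcd-class-size d e {{nonZero-factorˡ d e de≡n}} de≡n)))

  Σ∣-at-gcd : ∀ n .{{_ : NonZero n}} r (F : ℕ → ℕ → ℕ) →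
              let instance _ = gcd-nonZero r n in
              Σ∣ n (λ d e → when (d ≡ᵇ gcd r n) (F d e)) ≡ F (gcd r n) (n / gcd r n)
  Σ∣-at-gcd n r F = Σ∣-single n (gcd r n) _ F (m*[n/m]≡n {{gcd-nonZero r n}} (gcd[m,n]∣n r n))

  Σ∣-φ : ∀ n .{{_ : NonZero n}} → Σ∣ n (λ d _ → φ d) ≡ n
  Σ∣-φ n = begin
    Σ∣ n (λ d _ → φ d)                                          ≡⟨ Σ∣-involution n (λ d _ → φ d) ⟨
    Σ∣ n (λ _ e → φ e)                                           ≡⟨ Σ∣-cong n (λ _ e _ → *-identityˡ (φ e)) ⟨
    Σ∣ n (λ _ e → 1 * φ e)                                       ≡⟨ Σ<-by-gcd n (λ _ _ → 1) ⟨
    Σ< n (λ r → Σ∣ n (λ d e → when (d ≡ᵇ gcd r n) 1))           ≡⟨ Σ<-cong n (λ r _ → Σ∣-at-gcd n r (λ _ _ → 1)) ⟩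
    Σ< n (λ _ → 1)                                               ≡⟨ trans (Σ<-const n 1) (*-identityʳ n) ⟩
    n                                                            ∎

  φ-≤ : ∀ n → φ n ≤ n
  φ-≤ n = count≤-≤ _ n
    where
    count≤-≤ : ∀ p k → count≤ p k ≤ k
    count≤-≤ p zero    = z≤n
    count≤-≤ p (suc k) with p (suc k)
    ... | true  = s≤s (count≤-≤ p k)
    ... | false = m≤n⇒m≤1+n (count≤-≤ p k)

module HittingCounts where

  open import Defs using (module Walk; φ)
  open DivisorSums
  open Totient
  open import Data.Bool using (Bool; true; false; not; _∧_)
  open import Data.Fin using (Fin; toℕ)
  open import Data.List using (List; []; _∷_; map; concatMap; tabulate; _++_)
  open import Data.Vec using (_∷_)
  open import Data.Nat
  open import Data.Nat.Properties
  open import Data.Nat.DivMod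
  open import Data.Nat.Divisibility using (n∣m⇒m%n≡0; m%n≡0⇒n∣m; ∣n⇒∣m*n)
  open import Data.Nat.Coprimality as Coprime using (Coprime; coprime-divisor; coprime-/gcd)
  open import Data.Nat.GCD using (gcd; gcd[m,n]∣m; gcd[m,n]∣n; n/gcd[m,n]≢0)
  open import Data.Nat.Solver using (module +-*-Solver)
  open import Function using (mk⇔)
  open import Relation.Nullary.Decidable using (does-⇔)
  open import Relation.Binary.PropositionalEquality
  open ≡-Reasoning

  hits : ∀ n .{{_ : NonZero n}} → ℕ → ℕ → ℕ
  hits n x zero    = when (x ≡ᵇ 0) 1
  hits n x (suc k) = when (not (x ≡ᵇ 0)) (Σ< n (λ r → hits n ((x * r) % n) k))

  hitsFromOne : ℕ → ℕ → ℕ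
  hitsFromOne zero      k = 0
  hitsFromOne n@(suc _) k = hits n (1 % n) k

  hitsFromOne≡hits : ∀ n .{{_ : NonZero n}} k → hitsFromOne n k ≡ hits n (1 % n) k
  hitsFromOne≡hits (suc n) k = refl

  module _ (n : ℕ) .{{_ : NonZero n}} where

    open Walk n using (countTrue; hitsExactly; allVecs; hitCount)

    countTrue-++ : ∀ {A : Set} (p : A → Bool) xs ys →
                   countTrue p (xs ++ ys) ≡ countTrue p xs + countTrue p ys
    countTrue-++ p []       ys = refl
    countTrue-++ p (x ∷ xs) ys with p x
    ... | true  = cong suc (countTrue-++ p xs ys)
    ... | false = countTrue-++ p xs ys

    countTrue-map : ∀ {A B : Set} (p : B → Bool) (f : A → B) xs →
                    countTrue p (map f xs) ≡ countTrue (λ a → p (f a)) xs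
    countTrue-map p f []       = refl
    countTrue-map p f (x ∷ xs) with p (f x)
    ... | true  = cong suc (countTrue-map p f xs)
    ... | false = countTrue-map p f xs

    countTrue-∧ : ∀ {A : Set} b (p : A → Bool) xs → countTrue (λ a → b ∧ p a) xs ≡ when b (countTrue p xs)
    countTrue-∧ true  p xs       = refl
    countTrue-∧ false p []       = refl
    countTrue-∧ false p (x ∷ xs) = countTrue-∧ false p xs

    countTrue-concatMap : ∀ {A : Set} (p : A → Bool) m (f : Fin m → Fin n) (h : Fin n → List A) (g : ℕ → ℕ) →
                          (∀ i → countTrue p (h (f i)) ≡ g (toℕ i)) →
                          countTrue p (concatMap h (tabulate f)) ≡ Σ< m g
    countTrue-concatMap p zero    f h g eq = refl
    countTrue-concatMap p (suc m) f h g eq = trans (countTrue-++ p (h (f Fin.zero)) _)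
      (cong₂ _+_ (eq Fin.zero) (countTrue-concatMap p m (λ i → f (Fin.suc i)) h (λ i → g (suc i)) (λ i → eq (Fin.suc i))))
      where import Data.Fin as Fin

    countTrue-hitsExactly : ∀ k x → countTrue (hitsExactly x) (allVecs k) ≡ hits n x k
    countTrue-hitsExactly zero    x with x ≡ᵇ 0
    ... | true  = refl
    ... | false = refl
    countTrue-hitsExactly (suc k) x =
      trans (countTrue-concatMap (hitsExactly x) n (λ r → r) (λ r → map (r ∷_) (allVecs k))
               (λ r → when (not (x ≡ᵇ 0)) (hits n ((x * r) % n) k)) first-step)
            (sym (when-Σ< (not (x ≡ᵇ 0)) n _))
      where
      first-step : ∀ r → countTrue (hitsExactly x) (map (r ∷_) (allVecs k)) ≡ when (not (x ≡ᵇ 0)) (hits n ((x * toℕ r) % n) k)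
      first-step r = begin
        countTrue (hitsExactly x) (map (r ∷_) (allVecs k))
          ≡⟨ countTrue-map (hitsExactly x) (r ∷_) (allVecs k) ⟩
        countTrue (λ rs → not (x ≡ᵇ 0) ∧ hitsExactly ((x * toℕ r) % n) rs) (allVecs k)
          ≡⟨ countTrue-∧ (not (x ≡ᵇ 0)) _ (allVecs k) ⟩
        when (not (x ≡ᵇ 0)) (countTrue (hitsExactly ((x * toℕ r) % n)) (allVecs k))
          ≡⟨ cong (when (not (x ≡ᵇ 0))) (countTrue-hitsExactly k _) ⟩
        when (not (x ≡ᵇ 0)) (hits n ((x * toℕ r) % n) k) ∎

    hitCount≡hitsFromOne : ∀ k → hitCount k ≡ hitsFromOne n k
    hitCount≡hitsFromOne k = trans (countTrue-hitsExactly k (1 % n)) (sym (hitsFromOne≡hits n k))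

  ^-distribʳ-* : ∀ m n k → (m * n) ^ k ≡ m ^ k * n ^ k
  ^-distribʳ-* m n zero    = refl
  ^-distribʳ-* m n (suc k) = trans (cong (m * n *_) (^-distribʳ-* m n k))
    (solve 4 (λ m n x y → (m :* n) :* (x :* y) := (m :* x) :* (n :* y)) refl m n (m ^ k) (n ^ k))
    where open +-*-Solver

  Σ<-periodic : ∀ g m (h : ℕ → ℕ) → (∀ i j → h (i * m + j) ≡ h j) → Σ< (g * m) h ≡ g * Σ< m h
  Σ<-periodic g m h periodic = begin
    Σ< (g * m) h                                ≡⟨ Σ<-blocks g m h ⟩
    Σ< g (λ i → Σ< m (λ j → h (i * m + j)))     ≡⟨ Σ<-cong g (λ i _ → Σ<-cong m (λ j _ → periodic i j)) ⟩
    Σ< g (λ _ → Σ< m h)                         ≡⟨ Σ<-const g _ ⟩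
    g * Σ< m h                                  ∎

  *≡ᵇ0 : ∀ g .{{_ : NonZero g}} x → (g * x ≡ᵇ 0) ≡ (x ≡ᵇ 0)
  *≡ᵇ0 g x = does-⇔ (mk⇔ (λ gx≡0 → m*n≡0⇒m≡0 x g (trans (*-comm x g) gx≡0))
                          (λ x≡0 → trans (cong (g *_) x≡0) (*-zeroʳ g)))
                    (g * x ≟ 0) (x ≟ 0)

  hits-scale : ∀ g m .{{_ : NonZero g}} .{{_ : NonZero m}} x k →
               let instance _ = m*n≢0 g m in hits (g * m) (g * x) k ≡ g ^ k * hits m x k
  hits-scale g m x zero rewrite *≡ᵇ0 g x = sym (+-identityʳ _)
  hits-scale g m x (suc k) rewrite *≡ᵇ0 g x = begin
    when b (Σ< (g * m) (λ r → hits (g * m) ((g * x * r) % (g * m)) k))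
      ≡⟨ cong (when b) (Σ<-cong (g * m) (λ r _ → cong (λ y → hits (g * m) y k) (scale-% r))) ⟩
    when b (Σ< (g * m) (λ r → hits (g * m) (g * ((x * r) % m)) k))
      ≡⟨ cong (when b) (Σ<-cong (g * m) (λ r _ → hits-scale g m ((x * r) % m) k)) ⟩
    when b (Σ< (g * m) (λ r → g ^ k * H r))
      ≡⟨ cong (when b) (sym (Σ<-*ˡ (g * m) (g ^ k) H)) ⟩
    when b (g ^ k * Σ< (g * m) H)
      ≡⟨ cong (λ s → when b (g ^ k * s)) (Σ<-periodic g m H H-periodic) ⟩
    when b (g ^ k * (g * Σ< m H))
      ≡⟨ cong (when b) (x*[y*z]≡y*x*z (g ^ k) g (Σ< m H)) ⟩
    when b (g ^ suc k * Σ< m H)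
      ≡⟨ when-*ˡ b (g ^ suc k) (Σ< m H) ⟨
    g ^ suc k * when b (Σ< m H) ∎
    where
    open +-*-Solver
    instance _ = m*n≢0 g m
    instance _ = m*n≢0 m g
    b = not (x ≡ᵇ 0)
    H : ℕ → ℕ
    H r = hits m ((x * r) % m) k
    scale-% : ∀ r → (g * x * r) % (g * m) ≡ g * ((x * r) % m)
    scale-% r = begin
      (g * x * r) % (g * m)   ≡⟨ cong (_% (g * m)) (solve 3 (λ g x r → g :* x :* r := (x :* r) :* g) refl g x r) ⟩
      (x * r * g) % (g * m)   ≡⟨ %-congʳ (*-comm g m) ⟩
      (x * r * g) % (m * g)   ≡⟨ m%n*o≡m*o%[n*o] (x * r) m g ⟨
      (x * r) % m * g         ≡⟨ *-comm _ g ⟩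
      g * ((x * r) % m)       ∎
    H-periodic : ∀ i j → H (i * m + j) ≡ H j
    H-periodic i j = cong (λ y → hits m y k) (trans
      (cong (_% m) (solve 4 (λ x i m j → x :* (i :* m :+ j) := x :* j :+ (x :* i) :* m) refl x i m j))
      ([m+kn]%n≡m%n (x * j) (x * i) m))
    x*[y*z]≡y*x*z : ∀ x y z → x * (y * z) ≡ y * x * z
    x*[y*z]≡y*x*z = solve 3 (λ x y z → x :* (y :* z) := y :* x :* z) refl

  %-*ˡ-cong : ∀ a r m .{{_ : NonZero m}} → ((a % m) * r) % m ≡ (a * r) % m
  %-*ˡ-cong a r m = begin
    ((a % m) * r) % m             ≡⟨ %-distribˡ-* (a % m) r m ⟩
    ((a % m % m) * (r % m)) % m   ≡⟨ cong (λ z → (z * (r % m)) % m) (m%n%n≡m%n a m) ⟩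
    ((a % m) * (r % m)) % m       ≡⟨ %-distribˡ-* a r m ⟨
    (a * r) % m                   ∎

  module _ (m : ℕ) .{{_ : NonZero m}} (u : ℕ) (m⊥u : Coprime m u) where

    unit-%≡ᵇ0 : ∀ y → ((u * y) % m ≡ᵇ 0) ≡ (y % m ≡ᵇ 0)
    unit-%≡ᵇ0 y = does-⇔ (mk⇔
      (λ uy%m≡0 → n∣m⇒m%n≡0 y m (coprime-divisor m⊥u (m%n≡0⇒n∣m (u * y) m uy%m≡0)))
      (λ y%m≡0 → n∣m⇒m%n≡0 (u * y) m (∣n⇒∣m*n u (m%n≡0⇒n∣m y m y%m≡0))))
      ((u * y) % m ≟ 0) (y % m ≟ 0)

    hits-unit : ∀ k y → hits m ((u * y) % m) k ≡ hits m (y % m) k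
    hits-unit zero    y = cong (λ b → when b 1) (unit-%≡ᵇ0 y)
    hits-unit (suc k) y rewrite unit-%≡ᵇ0 y = cong (when (not (y % m ≡ᵇ 0))) (Σ<-cong m (λ r _ → begin
      hits m (((u * y) % m * r) % m) k
        ≡⟨ cong (λ z → hits m z k) (trans (%-*ˡ-cong (u * y) r m) (cong (_% m) (*-assoc u y r))) ⟩
      hits m ((u * (y * r)) % m) k       ≡⟨ hits-unit k (y * r) ⟩
      hits m ((y * r) % m) k             ≡⟨ cong (λ z → hits m z k) (%-*ˡ-cong y r m) ⟨
      hits m ((y % m * r) % m) k         ∎))

  hits-cong : ∀ {n n′ x x′} k .{{_ : NonZero n}} .{{_ : NonZero n′}} →
              n ≡ n′ → x ≡ x′ → hits n x k ≡ hits n′ x′ k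
  hits-cong k refl refl = refl

  -- Write n = g e and r = g x with g = gcd r n: scaling removes g, and x is a unit modulo e.
  hits-gcd : ∀ n .{{_ : NonZero n}} r k → r < n →
             let instance _ = gcd-nonZero r n in hits n r k ≡ gcd r n ^ k * hitsFromOne (n / gcd r n) k
  hits-gcd n r k r<n = begin
    hits n r k                  ≡⟨ hits-cong k (sym (m*[n/m]≡n (gcd[m,n]∣n r n))) (sym (m*[n/m]≡n (gcd[m,n]∣m r n))) ⟩
    hits (g * e) (g * x) k      ≡⟨ hits-scale g e x k ⟩
    g ^ k * hits e x k          ≡⟨ cong (λ y → g ^ k * hits e y k) (sym x*1%e≡x) ⟩
    g ^ k * hits e ((x * 1) % e) k ≡⟨ cong (g ^ k *_) (hits-unit e x (Coprime.sym (coprime-/gcd r n)) k 1) ⟩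
    g ^ k * hits e (1 % e) k    ≡⟨ cong (g ^ k *_) (hitsFromOne≡hits e k) ⟨
    g ^ k * hitsFromOne e k     ∎
    where
    instance _ = gcd-nonZero r n
    g = gcd r n
    instance _ = ≢-nonZero (n/gcd[m,n]≢0 r n)
    e = n / g
    x = r / g
    instance _ = m*n≢0 g e
    x*1%e≡x : (x * 1) % e ≡ x
    x*1%e≡x = trans (cong (_% e) (*-identityʳ x))
      (m<n⇒m%n≡m {n = e} (m<n*o⇒m/o<n (subst (r <_) (sym (m/n*n≡m (gcd[m,n]∣n r n))) r<n)))

  hitsFromOne-suc : ∀ n → 1 < n → ∀ k → hitsFromOne n (suc k) ≡ Σ∣ n (λ d e → e ^ k * hitsFromOne d k * φ d)
  hitsFromOne-suc n@(suc (suc _)) (s≤s (s≤s z≤n)) k rewrite m<n⇒m%n≡m {n = n} {m = 1} (s≤s (s≤s z≤n)) = begin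
    Σ< n (λ r → hits n ((1 * r) % n) k)
      ≡⟨ Σ<-cong n (λ r r<n → cong (λ y → hits n y k) (trans (cong (_% n) (*-identityˡ r)) (m<n⇒m%n≡m r<n))) ⟩
    Σ< n (λ r → hits n r k)
      ≡⟨ Σ<-cong n (λ r r<n → trans (hits-gcd n r k r<n) (sym (Σ∣-at-gcd n r (λ d e → d ^ k * hitsFromOne e k)))) ⟩
    Σ< n (λ r → Σ∣ n (λ d e → when (d ≡ᵇ gcd r n) (d ^ k * hitsFromOne e k)))
      ≡⟨ Σ<-by-gcd n (λ d e → d ^ k * hitsFromOne e k) ⟩
    Σ∣ n (λ d e → d ^ k * hitsFromOne e k * φ e)
      ≡⟨ Σ∣-involution n (λ d e → e ^ k * hitsFromOne d k * φ d) ⟩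
    Σ∣ n (λ d e → e ^ k * hitsFromOne d k * φ d) ∎

module NatToRat where

  open import Defs using (ℕ→ℚ)
  import Data.Nat as ℕ
  open import Data.Nat using (ℕ; suc)
  import Data.Nat.Properties as ℕ
  open import Data.Integer as ℤ using (ℤ; +_)
  import Data.Integer.Properties as ℤ
  import Data.Integer.Solver as ℤ-Solver
  import Data.Rational.Solver as ℚ-Solver
  open import Data.Rational
  open import Data.Rational.Properties
  open import Data.Rational.Unnormalised as ℚᵘ using (ℚᵘ; mkℚᵘ; *≡*)
  import Data.Rational.Unnormalised.Properties as ℚᵘ
  open import Relation.Binary.PropositionalEquality

  fromℚᵘ-+ : ∀ p q → fromℚᵘ (p ℚᵘ.+ q) ≡ fromℚᵘ p + fromℚᵘ q
  fromℚᵘ-+ p q = toℚᵘ-injective (ℚᵘ.≃-trans (toℚᵘ-fromℚᵘ _) (ℚᵘ.≃-sym (ℚᵘ.≃-trans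
    (toℚᵘ-homo-+ (fromℚᵘ p) (fromℚᵘ q)) (ℚᵘ.+-cong (toℚᵘ-fromℚᵘ p) (toℚᵘ-fromℚᵘ q)))))

  fromℚᵘ-* : ∀ p q → fromℚᵘ (p ℚᵘ.* q) ≡ fromℚᵘ p * fromℚᵘ q
  fromℚᵘ-* p q = toℚᵘ-injective (ℚᵘ.≃-trans (toℚᵘ-fromℚᵘ _) (ℚᵘ.≃-sym (ℚᵘ.≃-trans
    (toℚᵘ-homo-* (fromℚᵘ p) (fromℚᵘ q)) (ℚᵘ.*-cong (toℚᵘ-fromℚᵘ p) (toℚᵘ-fromℚᵘ q)))))

  fromℚᵘ-cross : ∀ p d q e → p ℤ.* + suc e ≡ q ℤ.* + suc d → fromℚᵘ (mkℚᵘ p d) ≡ fromℚᵘ (mkℚᵘ q e)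
  fromℚᵘ-cross p d q e eq = fromℚᵘ-cong {mkℚᵘ p d} {mkℚᵘ q e} (*≡* eq)

  ℕ→ℚ-+ : ∀ a b → ℕ→ℚ (a ℕ.+ b) ≡ ℕ→ℚ a + ℕ→ℚ b
  ℕ→ℚ-+ a b = trans (fromℚᵘ-cross (+ (a ℕ.+ b)) 0 (+ a ℤ.* + 1 ℤ.+ + b ℤ.* + 1) 0 eq)
                    (fromℚᵘ-+ (mkℚᵘ (+ a) 0) (mkℚᵘ (+ b) 0))
    where
    open ℤ-Solver.+-*-Solver
    eq : + (a ℕ.+ b) ℤ.* + 1 ≡ (+ a ℤ.* + 1 ℤ.+ + b ℤ.* + 1) ℤ.* + 1
    eq rewrite ℤ.pos-+ a b =
      solve 2 (λ a b → (a :+ b) :* con (+ 1) := (a :* con (+ 1) :+ b :* con (+ 1)) :* con (+ 1)) refl (+ a) (+ b)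

  ℕ→ℚ-* : ∀ a b → ℕ→ℚ (a ℕ.* b) ≡ ℕ→ℚ a * ℕ→ℚ b
  ℕ→ℚ-* a b = trans (fromℚᵘ-cross (+ (a ℕ.* b)) 0 (+ a ℤ.* + b) 0 eq) (fromℚᵘ-* (mkℚᵘ (+ a) 0) (mkℚᵘ (+ b) 0))
    where
    eq : + (a ℕ.* b) ℤ.* + 1 ≡ (+ a ℤ.* + b) ℤ.* + 1
    eq = cong (ℤ._* + 1) (ℤ.pos-* a b)

  ℕ→ℚ-cancel-/ : ∀ a d .{{_ : ℕ.NonZero d}} → ℕ→ℚ d * ((+ a) / d) ≡ ℕ→ℚ a
  ℕ→ℚ-cancel-/ a (suc d) = trans (sym (fromℚᵘ-* (mkℚᵘ (+ suc d) 0) (mkℚᵘ (+ a) d)))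
                                 (fromℚᵘ-cross (+ suc d ℤ.* + a) (d ℕ.+ 0) (+ a) 0 eq)
    where
    open ℤ-Solver.+-*-Solver
    eq : (+ suc d ℤ.* + a) ℤ.* + 1 ≡ + a ℤ.* + suc (d ℕ.+ 0)
    eq rewrite ℕ.+-identityʳ d = solve 2 (λ s a → (s :* a) :* con (+ 1) := a :* s) refl (+ suc d) (+ a)

  ℕ→ℚ-nonNeg : ∀ a → 0ℚ ≤ ℕ→ℚ a
  ℕ→ℚ-nonNeg a = nonNegative⁻¹ _ {{normalize-nonNeg a 1}}

  ℕ→ℚ-pos : ∀ a .{{_ : ℕ.NonZero a}} → Positive (ℕ→ℚ a)
  ℕ→ℚ-pos a = normalize-pos a 1

  ℕ→ℚ-mono : ∀ {a b} → a ℕ.≤ b → ℕ→ℚ a ≤ ℕ→ℚ b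
  ℕ→ℚ-mono {a} {b} a≤b = begin
    ℕ→ℚ a                        ≡⟨ +-identityʳ (ℕ→ℚ a) ⟨
    ℕ→ℚ a + 0ℚ                   ≤⟨ +-monoʳ-≤ (ℕ→ℚ a) (ℕ→ℚ-nonNeg (b ℕ.∸ a)) ⟩
    ℕ→ℚ a + ℕ→ℚ (b ℕ.∸ a)        ≡⟨ ℕ→ℚ-+ a (b ℕ.∸ a) ⟨
    ℕ→ℚ (a ℕ.+ (b ℕ.∸ a))        ≡⟨ cong ℕ→ℚ (ℕ.m+[n∸m]≡n a≤b) ⟩
    ℕ→ℚ b                        ∎
    where open ≤-Reasoning

  ℕ→ℚ-∸ : ∀ {a b} → b ℕ.≤ a → ℕ→ℚ (a ℕ.∸ b) ≡ ℕ→ℚ a - ℕ→ℚ b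
  ℕ→ℚ-∸ {a} {b} b≤a = begin
    ℕ→ℚ (a ℕ.∸ b)
      ≡⟨ solve 2 (λ x y → x := (y :+ x) :- y) refl (ℕ→ℚ (a ℕ.∸ b)) (ℕ→ℚ b) ⟩
    (ℕ→ℚ b + ℕ→ℚ (a ℕ.∸ b)) - ℕ→ℚ b
      ≡⟨ cong (_- ℕ→ℚ b) (trans (sym (ℕ→ℚ-+ b (a ℕ.∸ b))) (cong ℕ→ℚ (ℕ.m+[n∸m]≡n b≤a))) ⟩
    ℕ→ℚ a - ℕ→ℚ b ∎
    where
    open ≡-Reasoning
    open ℚ-Solver.+-*-Solver

  *-cancelˡ-≡-pos : ∀ r .{{_ : Positive r}} {p q} → r * p ≡ r * q → p ≡ q
  *-cancelˡ-≡-pos r rp≡rq =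
    ≤-antisym (*-cancelˡ-≤-pos r (≤-reflexive rp≡rq)) (*-cancelˡ-≤-pos r (≤-reflexive (sym rp≡rq)))

module Limits where

  open import Defs using (ℕ→ℚ)
  open NatToRat
  import Data.Nat as ℕ
  open import Data.Nat using (ℕ; zero; suc)
  import Data.Nat.Properties as ℕ
  open import Data.Integer using (+_; -[1+_])
  open import Data.Rational
  open import Data.Rational.Properties
  open import Data.Rational.Solver using (module +-*-Solver)
  open import Data.Product using (∃; _,_; proj₁; proj₂)
  open import Data.Empty using (⊥-elim)
  open import Relation.Nullary using (yes; no)
  open import Relation.Binary.Definitions using (tri<; tri≈; tri>)
  open import Relation.Binary.PropositionalEquality
  open +-*-Solver

  infix 4 _⟶_

  _⟶_ : (ℕ → ℚ) → ℚ → Set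
  s ⟶ L = ∀ (ε : ℚ) → 0ℚ < ε → ∃ λ N → ∀ K → N ℕ.≤ K → ∣ s K - L ∣ < ε

  private
    ½*-pos : ∀ ε → 0ℚ < ε → 0ℚ < ½ * ε
    ½*-pos ε 0<ε = subst (_< ½ * ε) (*-zeroʳ ½) (*-monoʳ-<-pos ½ 0<ε)

    ½*+½* : ∀ ε → ½ * ε + ½ * ε ≡ ε
    ½*+½* = solve 1 (λ ε → con ½ :* ε :+ con ½ :* ε := ε) refl

  ⟶-cong : ∀ {s t L} → (∀ K → s K ≡ t K) → s ⟶ L → t ⟶ L
  ⟶-cong s≗t s⟶L ε 0<ε with s⟶L ε 0<ε
  ... | N , close = N , λ K N≤K → subst (λ x → ∣ x - _ ∣ < ε) (s≗t K) (close K N≤K)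

  ⟶-const : ∀ c → (λ _ → c) ⟶ c
  ⟶-const c ε 0<ε = 0 , λ _ _ → subst (_< ε) (cong ∣_∣ (sym (+-inverseʳ c))) 0<ε

  ⟶-shift : ∀ {s L} → s ⟶ L → (λ K → s (suc K)) ⟶ L
  ⟶-shift s⟶L ε 0<ε with s⟶L ε 0<ε
  ... | N , close = N , λ K N≤K → close (suc K) (ℕ.m≤n⇒m≤1+n N≤K)

  ⟶-+ : ∀ {s t L M} → s ⟶ L → t ⟶ M → (λ K → s K + t K) ⟶ L + M
  ⟶-+ {s} {t} {L} {M} s⟶L t⟶M ε 0<ε with s⟶L (½ * ε) (½*-pos ε 0<ε) | t⟶M (½ * ε) (½*-pos ε 0<ε)
  ... | N₁ , close₁ | N₂ , close₂ = N₁ ℕ.⊔ N₂ , λ K N≤K → begin-strict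
    ∣ (s K + t K) - (L + M) ∣
      ≡⟨ cong ∣_∣ (solve 4 (λ a b c d → (a :+ b) :- (c :+ d) := (a :- c) :+ (b :- d)) refl (s K) (t K) L M) ⟩
    ∣ (s K - L) + (t K - M) ∣
      ≤⟨ ∣p+q∣≤∣p∣+∣q∣ (s K - L) (t K - M) ⟩
    ∣ s K - L ∣ + ∣ t K - M ∣
      <⟨ +-mono-< (close₁ K (ℕ.m⊔n≤o⇒m≤o N₁ N₂ N≤K)) (close₂ K (ℕ.m⊔n≤o⇒n≤o N₁ N₂ N≤K)) ⟩
    ½ * ε + ½ * ε
      ≡⟨ ½*+½* ε ⟩
    ε ∎
    where open ≤-Reasoning

  ⟶-*ℕ : ∀ m {s L} → s ⟶ L → (λ K → ℕ→ℚ m * s K) ⟶ ℕ→ℚ m * L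
  ⟶-*ℕ zero    {s} {L} _ = ⟶-cong (λ K → sym (*-zeroˡ (s K))) (subst ((λ _ → 0ℚ) ⟶_) (sym (*-zeroˡ L)) (⟶-const 0ℚ))
  ⟶-*ℕ (suc m) {s} {L} s⟶L = ⟶-cong (λ K → sym (suc-* (s K)))
    (subst ((λ K → s K + ℕ→ℚ m * s K) ⟶_) (sym (suc-* L)) (⟶-+ {s} {λ K → ℕ→ℚ m * s K} s⟶L (⟶-*ℕ m s⟶L)))
    where
    suc-* : ∀ x → ℕ→ℚ (suc m) * x ≡ x + ℕ→ℚ m * x
    suc-* x = trans (cong (_* x) (ℕ→ℚ-+ 1 m)) (solve 2 (λ m x → (con 1ℚ :+ m) :* x := x :+ m :* x) refl (ℕ→ℚ m) x)

  ⟶-unique : ∀ {s L M} → s ⟶ L → s ⟶ M → L ≡ M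
  ⟶-unique {s} {L} {M} s⟶L s⟶M with L ≟ M
  ... | yes L≡M = L≡M
  ... | no  L≢M = ⊥-elim (<-irrefl refl δ<δ)
    where
    δ = ∣ L - M ∣
    0<δ : 0ℚ < δ
    0<δ with <-cmp 0ℚ δ
    ... | tri< 0<δ _ _ = 0<δ
    ... | tri≈ _ 0≡δ _ = ⊥-elim (L≢M (p-q≡0⇒p≡q (∣p∣≡0⇒p≡0 (L - M) (sym 0≡δ))))
      where
      p-q≡0⇒p≡q : L - M ≡ 0ℚ → L ≡ M
      p-q≡0⇒p≡q L-M≡0 = trans (solve 2 (λ l m → l := (l :- m) :+ m) refl L M) (trans (cong (_+ M) L-M≡0) (+-identityˡ M))
    ... | tri> _ _ δ<0 = ⊥-elim (<-irrefl refl (<-≤-trans δ<0 (0≤∣p∣ (L - M))))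
    N₁ = proj₁ (s⟶L (½ * δ) (½*-pos δ 0<δ))
    N₂ = proj₁ (s⟶M (½ * δ) (½*-pos δ 0<δ))
    K = N₁ ℕ.⊔ N₂
    δ<δ : δ < δ
    δ<δ = begin-strict
      ∣ L - M ∣                         ≡⟨ cong ∣_∣ (solve 3 (λ l m x → l :- m := (x :- m) :- (x :- l)) refl L M (s K)) ⟩
      ∣ (s K - M) - (s K - L) ∣         ≤⟨ ∣p-q∣≤∣p∣+∣q∣ (s K - M) (s K - L) ⟩
      ∣ s K - M ∣ + ∣ s K - L ∣         <⟨ +-mono-< (proj₂ (s⟶M (½ * δ) (½*-pos δ 0<δ)) K (ℕ.m≤n⊔m N₁ N₂))
                                                    (proj₂ (s⟶L (½ * δ) (½*-pos δ 0<δ)) K (ℕ.m≤m⊔n N₁ N₂)) ⟩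
      ½ * δ + ½ * δ                     ≡⟨ ½*+½* δ ⟩
      δ                                 ∎
      where open ≤-Reasoning

  archimedean : ∀ ε → 0ℚ < ε → ∃ λ A → 1ℚ ≤ ε * ℕ→ℚ A
  archimedean ε@(mkℚ (+ zero) _ _) 0<ε = ⊥-elim (<-irrefl (sym (↥p≡0⇒p≡0 ε refl)) 0<ε)
  archimedean ε@(mkℚ -[1+ _ ] _ _) 0<ε = ⊥-elim (<-asym 0<ε (negative⁻¹ ε))
  archimedean ε@(mkℚ (+ suc n) q _) _ = suc q , (begin
    1ℚ                                      ≤⟨ ℕ→ℚ-mono {1} {suc n} (ℕ.s≤s ℕ.z≤n) ⟩
    ℕ→ℚ (suc n)                             ≡⟨ ℕ→ℚ-cancel-/ (suc n) (suc q) ⟨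
    ℕ→ℚ (suc q) * ((+ suc n) / suc q)       ≡⟨ cong (ℕ→ℚ (suc q) *_) (↥p/↧p≡p ε) ⟩
    ℕ→ℚ (suc q) * ε                         ≡⟨ *-comm (ℕ→ℚ (suc q)) ε ⟩
    ε * ℕ→ℚ (suc q)                         ∎)
    where open ≤-Reasoning

module Probabilities where

  open import Algebra.Bundles using (CommutativeRing)
  open import Defs using (module Walk; φ; ℕ→ℚ)
  open DivisorSums
  module ℕΣ = Totient
  open HittingCounts
  open NatToRat
  import Data.Nat as ℕ
  open import Data.Nat using (ℕ; zero; suc; _^_; s≤s; z≤n)
  open import Data.Nat.Divisibility using (_∣?_)
  import Data.Nat.Properties as ℕ
  open import Data.Rational
  open import Data.Rational.Properties
  open import Data.Rational.Solver using (module +-*-Solver)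
  open import Relation.Nullary using (Dec; yes; no)
  open import Relation.Binary.PropositionalEquality
  open ≡-Reasoning

  open FiniteSums (CommutativeRing.commutativeSemiring +-*-commutativeRing) public

  -- Junk value 0 at the modulus 0, which never occurs as a divisor.
  hitProb : ℕ → ℕ → ℚ
  hitProb zero      k = 0ℚ
  hitProb n@(suc _) k = Walk.probHitAt n k

  partialExp : ℕ → ℕ → ℚ
  partialExp zero      K = 0ℚ
  partialExp n@(suc _) K = Walk.partialExpectation n K

  cumProb : ℕ → ℕ → ℚ
  cumProb n K = Σ< (suc K) (hitProb n)

  Σφ : ℕ → (ℕ → ℚ) → ℚ
  Σφ n F = Σ∣ n (λ d _ → ℕ→ℚ (φ d) * F d)

  partialExp-suc : ∀ n K → partialExp n (suc K) ≡ partialExp n K + ℕ→ℚ (suc K) * hitProb n (suc K)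
  partialExp-suc zero    K = sym (trans (+-identityˡ _) (*-zeroʳ (ℕ→ℚ (suc K))))
  partialExp-suc (suc n) K = refl

  cumProb-suc : ∀ n K → cumProb n (suc K) ≡ cumProb n K + hitProb n (suc K)
  cumProb-suc n K = Σ<-snoc (suc K) (hitProb n)

  hitProb-nonNeg : ∀ n k → 0ℚ ≤ hitProb n k
  hitProb-nonNeg zero    k = ≤-refl
  hitProb-nonNeg (suc n) k =
    nonNegative⁻¹ _ {{normalize-nonNeg (Walk.hitCount (suc n) k) (suc n ^ k) {{ℕ.m^n≢0 (suc n) k}}}}

  hitProb-scaled : ∀ n .{{_ : ℕ.NonZero n}} k → ℕ→ℚ (n ^ k) * hitProb n k ≡ ℕ→ℚ (hitsFromOne n k)
  hitProb-scaled n@(suc _) k = trans (ℕ→ℚ-cancel-/ (Walk.hitCount n k) (n ^ k) {{ℕ.m^n≢0 n k}})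
                                     (cong ℕ→ℚ (hitCount≡hitsFromOne n k))

  ℕ→ℚ-Σ< : ∀ n f → ℕ→ℚ (ℕΣ.Σ< n f) ≡ Σ< n (λ i → ℕ→ℚ (f i))
  ℕ→ℚ-Σ< zero    f = refl
  ℕ→ℚ-Σ< (suc n) f = trans (ℕ→ℚ-+ (f 0) _) (cong (ℕ→ℚ (f 0) +_) (ℕ→ℚ-Σ< n (λ i → f (suc i))))

  ℕ→ℚ-Σ∣ : ∀ n F → ℕ→ℚ (ℕΣ.Σ∣ n F) ≡ Σ∣ n (λ d e → ℕ→ℚ (F d e))
  ℕ→ℚ-Σ∣ n F = trans (ℕ→ℚ-Σ< n _) (Σ<-cong n (λ i _ → term (suc i ∣? n)))
    where
    open import Data.Nat.Divisibility using (_∣_)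
    term : ∀ {i} (i? : Dec (suc i ∣ n)) → ℕ→ℚ (ℕΣ.onDivisor n i i? F) ≡ onDivisor n i i? (λ d e → ℕ→ℚ (F d e))
    term (yes _) = refl
    term (no  _) = refl

  Σφ-cong : ∀ n {F G} → (∀ d e → d ℕ.* e ≡ n → F d ≡ G d) → Σφ n F ≡ Σφ n G
  Σφ-cong n F≡G = Σ∣-cong n (λ d e de≡n → cong (ℕ→ℚ (φ d) *_) (F≡G d e de≡n))

  Σφ-+ : ∀ n F G → Σφ n (λ d → F d + G d) ≡ Σφ n F + Σφ n G
  Σφ-+ n F G = trans (Σ∣-cong n (λ d _ _ → *-distribˡ-+ (ℕ→ℚ (φ d)) (F d) (G d))) (Σ∣-+ n _ _)

  Σφ-*ˡ : ∀ n x F → x * Σφ n F ≡ Σφ n (λ d → x * F d)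
  Σφ-*ˡ n x F = trans (Σ∣-*ˡ n x _) (Σ∣-cong n (λ d _ _ →
    solve 3 (λ x y z → x :* (y :* z) := y :* (x :* z)) refl x (ℕ→ℚ (φ d)) (F d)))
    where open +-*-Solver

  Σ<-Σφ : ∀ m n (f : ℕ → ℕ → ℚ) → Σ< m (λ k → Σφ n (λ d → f d k)) ≡ Σφ n (λ d → Σ< m (f d))
  Σ<-Σφ m n f = trans (Σ<-Σ∣-swap m n _) (Σ∣-cong n (λ d _ _ → sym (Σ<-*ˡ m (ℕ→ℚ (φ d)) (f d))))

  Σφ-1 : ∀ n .{{_ : ℕ.NonZero n}} → Σφ n (λ _ → 1ℚ) ≡ ℕ→ℚ n
  Σφ-1 n = begin
    Σφ n (λ _ → 1ℚ)                 ≡⟨ Σ∣-cong n (λ d _ _ → *-identityʳ (ℕ→ℚ (φ d))) ⟩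
    Σ∣ n (λ d _ → ℕ→ℚ (φ d))        ≡⟨ ℕ→ℚ-Σ∣ n (λ d _ → φ d) ⟨
    ℕ→ℚ (ℕΣ.Σ∣ n (λ d _ → φ d))     ≡⟨ cong ℕ→ℚ (ℕΣ.Σ∣-φ n) ⟩
    ℕ→ℚ n                           ∎

  -- Multiplying through by n^k turns the claim into the count recurrence hitsFromOne-suc.
  hitProb-suc : ∀ n → 1 ℕ.< n → ∀ k → ℕ→ℚ n * hitProb n (suc k) ≡ Σφ n (λ d → hitProb d k)
  hitProb-suc n@(suc (suc _)) 1<n@(s≤s (s≤s z≤n)) k = *-cancelˡ-≡-pos (ℕ→ℚ (n ^ k)) (begin
    ℕ→ℚ (n ^ k) * (ℕ→ℚ n * hitProb n (suc k))
      ≡⟨ *-assoc (ℕ→ℚ (n ^ k)) (ℕ→ℚ n) (hitProb n (suc k)) ⟨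
    (ℕ→ℚ (n ^ k) * ℕ→ℚ n) * hitProb n (suc k)
      ≡⟨ cong (_* hitProb n (suc k)) (trans (sym (ℕ→ℚ-* (n ^ k) n)) (cong ℕ→ℚ (ℕ.*-comm (n ^ k) n))) ⟩
    ℕ→ℚ (n ^ suc k) * hitProb n (suc k)
      ≡⟨ hitProb-scaled n (suc k) ⟩
    ℕ→ℚ (hitsFromOne n (suc k))
      ≡⟨ cong ℕ→ℚ (hitsFromOne-suc n 1<n k) ⟩
    ℕ→ℚ (ℕΣ.Σ∣ n (λ d e → e ^ k ℕ.* hitsFromOne d k ℕ.* φ d))
      ≡⟨ ℕ→ℚ-Σ∣ n _ ⟩
    Σ∣ n (λ d e → ℕ→ℚ (e ^ k ℕ.* hitsFromOne d k ℕ.* φ d))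
      ≡⟨ Σ∣-cong n term ⟨
    Σ∣ n (λ d _ → ℕ→ℚ (n ^ k) * (ℕ→ℚ (φ d) * hitProb d k))
      ≡⟨ Σ∣-*ˡ n (ℕ→ℚ (n ^ k)) _ ⟨
    ℕ→ℚ (n ^ k) * Σφ n (λ d → hitProb d k) ∎)
    where
    open +-*-Solver
    instance _ = ℕ→ℚ-pos (n ^ k) {{ℕ.m^n≢0 n k}}
    term : ∀ d e → d ℕ.* e ≡ n →
           ℕ→ℚ (n ^ k) * (ℕ→ℚ (φ d) * hitProb d k) ≡ ℕ→ℚ (e ^ k ℕ.* hitsFromOne d k ℕ.* φ d)
    term d e de≡n = begin
      ℕ→ℚ (n ^ k) * (ℕ→ℚ (φ d) * hitProb d k)
        ≡⟨ cong (λ m → ℕ→ℚ m * (ℕ→ℚ (φ d) * hitProb d k)) (trans (cong (_^ k) (sym de≡n)) (^-distribʳ-* d e k)) ⟩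
      ℕ→ℚ (d ^ k ℕ.* e ^ k) * (ℕ→ℚ (φ d) * hitProb d k)
        ≡⟨ cong (_* (ℕ→ℚ (φ d) * hitProb d k)) (ℕ→ℚ-* (d ^ k) (e ^ k)) ⟩
      (ℕ→ℚ (d ^ k) * ℕ→ℚ (e ^ k)) * (ℕ→ℚ (φ d) * hitProb d k)
        ≡⟨ solve 4 (λ D E Φ p → (D :* E) :* (Φ :* p) := E :* (D :* p) :* Φ) refl
                   (ℕ→ℚ (d ^ k)) (ℕ→ℚ (e ^ k)) (ℕ→ℚ (φ d)) (hitProb d k) ⟩
      ℕ→ℚ (e ^ k) * (ℕ→ℚ (d ^ k) * hitProb d k) * ℕ→ℚ (φ d)
        ≡⟨ cong (λ x → ℕ→ℚ (e ^ k) * x * ℕ→ℚ (φ d)) (hitProb-scaled d {{nonZero-factorˡ d e de≡n}} k) ⟩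
      ℕ→ℚ (e ^ k) * ℕ→ℚ (hitsFromOne d k) * ℕ→ℚ (φ d)
        ≡⟨ trans (cong (_* ℕ→ℚ (φ d)) (sym (ℕ→ℚ-* (e ^ k) (hitsFromOne d k))))
                 (sym (ℕ→ℚ-* (e ^ k ℕ.* hitsFromOne d k) (φ d))) ⟩
      ℕ→ℚ (e ^ k ℕ.* hitsFromOne d k ℕ.* φ d) ∎

  partialExp-zero : ∀ n → partialExp n 0 ≡ 0ℚ
  partialExp-zero zero    = refl
  partialExp-zero (suc n) = refl

  hitProb-zero : ∀ n → 1 ℕ.< n → hitProb n 0 ≡ 0ℚ
  hitProb-zero n@(suc (suc _)) (s≤s (s≤s z≤n)) =
    trans (sym (*-identityˡ (hitProb n 0)))
          (trans (hitProb-scaled n 0) (cong (λ x → ℕ→ℚ (ℕΣ.when (x ℕ.≡ᵇ 0) 1)) 1%n≡1))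
    where
    open import Data.Nat.DivMod using (_%_; m<n⇒m%n≡m)
    1%n≡1 : 1 % n ≡ 1
    1%n≡1 = m<n⇒m%n≡m {n = n} (s≤s (s≤s z≤n))

  cumProb-rec : ∀ n → 1 ℕ.< n → ∀ K → ℕ→ℚ n * cumProb n (suc K) ≡ Σφ n (λ d → cumProb d K)
  cumProb-rec n 1<n K = begin
    ℕ→ℚ n * (hitProb n 0 + Σ< (suc K) (λ k → hitProb n (suc k)))
      ≡⟨ cong (λ p → ℕ→ℚ n * (p + Σ< (suc K) (λ k → hitProb n (suc k)))) (hitProb-zero n 1<n) ⟩
    ℕ→ℚ n * (0ℚ + Σ< (suc K) (λ k → hitProb n (suc k)))
      ≡⟨ cong (ℕ→ℚ n *_) (+-identityˡ _) ⟩
    ℕ→ℚ n * Σ< (suc K) (λ k → hitProb n (suc k))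
      ≡⟨ Σ<-*ˡ (suc K) (ℕ→ℚ n) (λ k → hitProb n (suc k)) ⟩
    Σ< (suc K) (λ k → ℕ→ℚ n * hitProb n (suc k))
      ≡⟨ Σ<-cong (suc K) (λ k _ → hitProb-suc n 1<n k) ⟩
    Σ< (suc K) (λ k → Σφ n (λ d → hitProb d k))
      ≡⟨ Σ<-Σφ (suc K) n hitProb ⟩
    Σφ n (λ d → cumProb d K) ∎

  partialExp-rec : ∀ n → 1 ℕ.< n → ∀ K → ℕ→ℚ n * partialExp n (suc K) ≡ Σφ n (λ d → partialExp d K + cumProb d K)
  partialExp-rec n 1<n zero = begin
    ℕ→ℚ n * partialExp n 1
      ≡⟨ cong (ℕ→ℚ n *_) (trans (partialExp-suc n 0) (trans (cong (_+ ℕ→ℚ 1 * hitProb n 1) (partialExp-zero n))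
                                                               (trans (+-identityˡ _) (*-identityˡ _)))) ⟩
    ℕ→ℚ n * hitProb n 1
      ≡⟨ hitProb-suc n 1<n 0 ⟩
    Σφ n (λ d → hitProb d 0)
      ≡⟨ Σφ-cong n (λ d _ _ → sym (trans (cong (_+ cumProb d 0) (partialExp-zero d))
                                         (trans (+-identityˡ _) (+-identityʳ _)))) ⟩
    Σφ n (λ d → partialExp d 0 + cumProb d 0) ∎
  partialExp-rec n 1<n (suc K) = begin
    ℕ→ℚ n * partialExp n (suc (suc K))
      ≡⟨ cong (ℕ→ℚ n *_) (partialExp-suc n (suc K)) ⟩
    ℕ→ℚ n * (partialExp n (suc K) + c * hitProb n (suc (suc K)))
      ≡⟨ solve 4 (λ n p c q → n :* (p :+ c :* q) := n :* p :+ c :* (n :* q)) refl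
                 (ℕ→ℚ n) (partialExp n (suc K)) c (hitProb n (suc (suc K))) ⟩
    ℕ→ℚ n * partialExp n (suc K) + c * (ℕ→ℚ n * hitProb n (suc (suc K)))
      ≡⟨ cong₂ _+_ (partialExp-rec n 1<n K) (trans (cong (c *_) (hitProb-suc n 1<n (suc K))) (Σφ-*ˡ n c _)) ⟩
    Σφ n (λ d → partialExp d K + cumProb d K) + Σφ n (λ d → c * hitProb d (suc K))
      ≡⟨ Σφ-+ n _ _ ⟨
    Σφ n (λ d → (partialExp d K + cumProb d K) + c * hitProb d (suc K))
      ≡⟨ Σφ-cong n (λ d _ _ → step d) ⟩
    Σφ n (λ d → partialExp d (suc K) + cumProb d (suc K)) ∎
    where
    open +-*-Solver
    c = ℕ→ℚ (suc (suc K))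
    step : ∀ d → (partialExp d K + cumProb d K) + c * hitProb d (suc K) ≡ partialExp d (suc K) + cumProb d (suc K)
    step d = begin
      (partialExp d K + cumProb d K) + c * hitProb d (suc K)
        ≡⟨ cong (λ x → (partialExp d K + cumProb d K) + x * hitProb d (suc K)) (ℕ→ℚ-+ 1 (suc K)) ⟩
      (partialExp d K + cumProb d K) + (1ℚ + ℕ→ℚ (suc K)) * hitProb d (suc K)
        ≡⟨ solve 4 (λ e s k p → (e :+ s) :+ (con 1ℚ :+ k) :* p := (e :+ k :* p) :+ (s :+ p)) refl
             (partialExp d K) (cumProb d K) (ℕ→ℚ (suc K)) (hitProb d (suc K)) ⟩
      (partialExp d K + ℕ→ℚ (suc K) * hitProb d (suc K)) + (cumProb d K + hitProb d (suc K))
        ≡⟨ cong₂ _+_ (partialExp-suc d K) (cumProb-suc d K) ⟨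
      partialExp d (suc K) + cumProb d (suc K) ∎

module Absorption where

  open import Defs using (φ; ℕ→ℚ)
  open DivisorSums
  open NatToRat
  open Limits
  open Probabilities
  import Data.Nat as ℕ
  open import Data.Nat using (ℕ; zero; suc; s≤s; z≤n)
  import Data.Nat.Properties as ℕ
  open import Data.Nat.Divisibility using (_∣_; _∣?_)
  open import Data.Bool using (not)
  open import Data.Product using (_×_; _,_; proj₁; proj₂)
  open import Data.Rational
  open import Data.Rational.Properties
  open import Data.Rational.Solver using (module +-*-Solver)
  open import Relation.Nullary using (Dec; yes; no)
  open import Relation.Nullary.Decidable using (dec-false)
  open import Relation.Binary.PropositionalEquality
  open +-*-Solver

  Σ<-mono : ∀ n {f g} → (∀ i → i ℕ.< n → f i ≤ g i) → Σ< n f ≤ Σ< n g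
  Σ<-mono zero    f≤g = ≤-refl
  Σ<-mono (suc n) f≤g = +-mono-≤ (f≤g 0 (s≤s z≤n)) (Σ<-mono n (λ i i<n → f≤g (suc i) (s≤s i<n)))

  Σφ-mono : ∀ n {F G} → (∀ d e → d ℕ.* e ≡ n → F d ≤ G d) → Σφ n F ≤ Σφ n G
  Σφ-mono n {F} {G} F≤G = Σ<-mono n (λ i _ → term (suc i ∣? n))
    where
    open import Data.Nat.DivMod using (m*[n/m]≡n)
    term : ∀ {i} (i? : Dec (suc i ∣ n)) →
           onDivisor n i i? (λ d _ → ℕ→ℚ (φ d) * F d) ≤ onDivisor n i i? (λ d _ → ℕ→ℚ (φ d) * G d)
    term {i} (yes i+1∣n) = *-monoˡ-≤-nonNeg (ℕ→ℚ (φ (suc i))) {{nonNegative (ℕ→ℚ-nonNeg (φ (suc i)))}}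
                                             (F≤G (suc i) _ (m*[n/m]≡n i+1∣n))
    term (no  _)     = ≤-refl

  Σφ-remove-1 : ∀ n .{{_ : ℕ.NonZero n}} F → Σφ n F ≡ F 1 + Σφ n (λ d → when (not (d ℕ.≡ᵇ 1)) (F d))
  Σφ-remove-1 n F = trans (Σ∣-remove n 1 n _ (ℕ.*-identityˡ n))
    (cong₂ _+_ (*-identityˡ (F 1)) (Σ∣-cong n (λ d _ _ → sym (when-*ˡ (not (d ℕ.≡ᵇ 1)) (ℕ→ℚ (φ d)) (F d)))))

  cumProb-one : ∀ K → cumProb 1 K ≡ 1ℚ
  cumProb-one K = trans (cong (1ℚ +_) (Σ<-zero K (λ k _ → hitProb-1 k))) (+-identityʳ 1ℚ)
    where
    hitProb-1 : ∀ k → hitProb 1 (suc k) ≡ 0ℚ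
    hitProb-1 k = trans (sym (trans (cong (λ m → ℕ→ℚ m * hitProb 1 (suc k)) (ℕ.^-zeroˡ (suc k))) (*-identityˡ _)))
                        (hitProb-scaled 1 (suc k))

  cumProb-nonNeg : ∀ d K → 0ℚ ≤ cumProb d K
  cumProb-nonNeg d K = ≤-trans (≤-reflexive (sym (Σ<-zero (suc K) (λ _ _ → refl))))
                               (Σ<-mono (suc K) (λ k _ → hitProb-nonNeg d k))

  survival-rec : ∀ d → 1 ℕ.< d → ∀ K → ℕ→ℚ d * (1ℚ - cumProb d (suc K)) ≡ Σφ d (λ e → 1ℚ - cumProb e K)
  survival-rec d@(suc (suc _)) 1<d@(s≤s (s≤s z≤n)) K = begin
    ℕ→ℚ d * (1ℚ - cumProb d (suc K))
      ≡⟨ solve 2 (λ x p → x :* (con 1ℚ :- p) := x :- x :* p) refl (ℕ→ℚ d) (cumProb d (suc K)) ⟩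
    ℕ→ℚ d - ℕ→ℚ d * cumProb d (suc K)
      ≡⟨ cong₂ _-_ (sym (Σφ-1 d)) (cumProb-rec d 1<d K) ⟩
    Σφ d (λ _ → 1ℚ) - Σφ d C
      ≡⟨ cong (_- Σφ d C) (trans (Σφ-cong d (λ e _ _ → solve 1 (λ c → con 1ℚ := (con 1ℚ :- c) :+ c) refl (C e)))
                                 (Σφ-+ d S C)) ⟩
    (Σφ d S + Σφ d C) - Σφ d C
      ≡⟨ solve 2 (λ s c → (s :+ c) :- c := s) refl (Σφ d S) (Σφ d C) ⟩
    Σφ d S ∎
    where
    open ≡-Reasoning
    C S : ℕ → ℚ
    C e = cumProb e K
    S e = 1ℚ - cumProb e K

  SurvivalBound : ℕ → ℕ → ℕ → Set
  SurvivalBound N K d = cumProb d K ≤ 1ℚ × (1ℚ - cumProb d K) * ℕ→ℚ (N ℕ.+ K) ≤ ℕ→ℚ N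

  -- d · P_d(T > K+1) = Σ_{e ∣ d} φ(e) P_e(T > K) by survival-rec, and the term e = 1 vanishes,
  -- so the induction hypothesis is only needed with total weight d - 1.
  survival-bound-step : ∀ N K d → 1 ℕ.< d → d ℕ.≤ N →
                        (∀ e f → e ℕ.* f ≡ d → SurvivalBound N K e) → SurvivalBound N (suc K) d
  survival-bound-step N K d@(suc (suc _)) 1<d@(s≤s (s≤s z≤n)) d≤N IH = cumProb≤1 , Q*[N+K+1]≤N
    where
    open ≤-Reasoning
    instance _ = ℕ→ℚ-pos d
    S : ℕ → ℚ
    S e = 1ℚ - cumProb e K
    Q = 1ℚ - cumProb d (suc K)
    M = ℕ→ℚ (N ℕ.+ K)
    X = ℕ→ℚ d * Q
    cumProb≤1 : cumProb d (suc K) ≤ 1ℚ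
    cumProb≤1 = *-cancelˡ-≤-pos (ℕ→ℚ d) (begin
      ℕ→ℚ d * cumProb d (suc K)     ≡⟨ cumProb-rec d 1<d K ⟩
      Σφ d (λ e → cumProb e K)      ≤⟨ Σφ-mono d (λ e f ef≡d → proj₁ (IH e f ef≡d)) ⟩
      Σφ d (λ _ → 1ℚ)               ≡⟨ Σφ-1 d ⟩
      ℕ→ℚ d                         ≡⟨ *-identityʳ (ℕ→ℚ d) ⟨
      ℕ→ℚ d * 1ℚ                    ∎)
    per-divisor : ∀ e f → e ℕ.* f ≡ d → S e * M ≤ when (not (e ℕ.≡ᵇ 1)) (ℕ→ℚ N)
    per-divisor e f ef≡d with e ℕ.≟ 1
    ... | yes refl = ≤-reflexive (trans (cong (λ c → (1ℚ - c) * M) (cumProb-one K)) (*-zeroˡ M))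
    ... | no  e≢1 rewrite dec-false (e ℕ.≟ 1) e≢1 = proj₂ (IH e f ef≡d)
    X*M≤[d-1]*N : X * M ≤ (ℕ→ℚ d - 1ℚ) * ℕ→ℚ N
    X*M≤[d-1]*N = begin
      X * M                                          ≡⟨ cong (_* M) (survival-rec d 1<d K) ⟩
      Σφ d S * M                                     ≡⟨ trans (*-comm _ M) (Σφ-*ˡ d M S) ⟩
      Σφ d (λ e → M * S e)                           ≡⟨ Σφ-cong d (λ e _ _ → *-comm M (S e)) ⟩
      Σφ d (λ e → S e * M)                           ≤⟨ Σφ-mono d per-divisor ⟩
      Σφ d (λ e → when (not (e ℕ.≡ᵇ 1)) (ℕ→ℚ N))
        ≡⟨ solve 2 (λ s n → s := (n :+ s) :- n) refl _ (ℕ→ℚ N) ⟩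
      (ℕ→ℚ N + Σφ d (λ e → when (not (e ℕ.≡ᵇ 1)) (ℕ→ℚ N))) - ℕ→ℚ N
        ≡⟨ cong (_- ℕ→ℚ N) (Σφ-remove-1 d (λ _ → ℕ→ℚ N)) ⟨
      Σφ d (λ _ → ℕ→ℚ N) - ℕ→ℚ N
        ≡⟨ cong (_- ℕ→ℚ N) Σφ-const ⟩
      ℕ→ℚ d * ℕ→ℚ N - ℕ→ℚ N
        ≡⟨ solve 2 (λ d n → d :* n :- n := (d :- con 1ℚ) :* n) refl (ℕ→ℚ d) (ℕ→ℚ N) ⟩
      (ℕ→ℚ d - 1ℚ) * ℕ→ℚ N ∎
      where
      Σφ-const : Σφ d (λ _ → ℕ→ℚ N) ≡ ℕ→ℚ d * ℕ→ℚ N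
      Σφ-const = begin-equality
        Σφ d (λ _ → ℕ→ℚ N)                ≡⟨ Σφ-cong d (λ _ _ _ → *-identityʳ (ℕ→ℚ N)) ⟨
        Σφ d (λ _ → ℕ→ℚ N * 1ℚ)           ≡⟨ Σφ-*ˡ d (ℕ→ℚ N) (λ _ → 1ℚ) ⟨
        ℕ→ℚ N * Σφ d (λ _ → 1ℚ)           ≡⟨ trans (cong (ℕ→ℚ N *_) (Σφ-1 d)) (*-comm (ℕ→ℚ N) (ℕ→ℚ d)) ⟩
        ℕ→ℚ d * ℕ→ℚ N                     ∎
    Q≤1 : Q ≤ 1ℚ
    Q≤1 = ≤-trans (+-monoʳ-≤ 1ℚ (neg-antimono-≤ (cumProb-nonNeg d (suc K)))) (≤-reflexive (+-identityʳ 1ℚ))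
    X≤N : X ≤ ℕ→ℚ N
    X≤N = begin
      ℕ→ℚ d * Q              ≤⟨ *-monoˡ-≤-nonNeg (ℕ→ℚ d) {{nonNegative (ℕ→ℚ-nonNeg d)}} Q≤1 ⟩
      ℕ→ℚ d * 1ℚ             ≡⟨ *-identityʳ (ℕ→ℚ d) ⟩
      ℕ→ℚ d                  ≤⟨ ℕ→ℚ-mono d≤N ⟩
      ℕ→ℚ N                  ∎
    Q*[N+K+1]≤N : Q * ℕ→ℚ (N ℕ.+ suc K) ≤ ℕ→ℚ N
    Q*[N+K+1]≤N = *-cancelˡ-≤-pos (ℕ→ℚ d) (begin
      ℕ→ℚ d * (Q * ℕ→ℚ (N ℕ.+ suc K))
        ≡⟨ cong (λ m → ℕ→ℚ d * (Q * ℕ→ℚ m)) (ℕ.+-suc N K) ⟩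
      ℕ→ℚ d * (Q * ℕ→ℚ (1 ℕ.+ (N ℕ.+ K)))
        ≡⟨ cong (λ m → ℕ→ℚ d * (Q * m)) (ℕ→ℚ-+ 1 (N ℕ.+ K)) ⟩
      ℕ→ℚ d * (Q * (1ℚ + M))
        ≡⟨ solve 3 (λ x q m → x :* (q :* (con 1ℚ :+ m)) := (x :* q) :* m :+ x :* q) refl (ℕ→ℚ d) Q M ⟩
      X * M + X
        ≤⟨ +-mono-≤ X*M≤[d-1]*N X≤N ⟩
      (ℕ→ℚ d - 1ℚ) * ℕ→ℚ N + ℕ→ℚ N
        ≡⟨ solve 2 (λ x n → (x :- con 1ℚ) :* n :+ n := x :* n) refl (ℕ→ℚ d) (ℕ→ℚ N) ⟩
      ℕ→ℚ d * ℕ→ℚ N ∎)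

  survival-bound : ∀ N K d → 1 ℕ.≤ d → d ℕ.≤ N → SurvivalBound N K d
  survival-bound N K (suc zero) _ _ = ≤-reflexive (cumProb-one K) ,
    ≤-trans (≤-reflexive (trans (cong (λ c → (1ℚ - c) * ℕ→ℚ (N ℕ.+ K)) (cumProb-one K)) (*-zeroˡ (ℕ→ℚ (N ℕ.+ K)))))
            (ℕ→ℚ-nonNeg N)
  survival-bound N zero d@(suc (suc _)) _ _ = ≤-trans (≤-reflexive cumProb-0) (nonNegative⁻¹ 1ℚ) ,
    ≤-reflexive (trans (cong (λ c → (1ℚ - c) * ℕ→ℚ (N ℕ.+ 0)) cumProb-0)
                       (trans (*-identityˡ _) (cong ℕ→ℚ (ℕ.+-identityʳ N))))
    where
    cumProb-0 : cumProb d 0 ≡ 0ℚ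
    cumProb-0 = trans (+-identityʳ _) (hitProb-zero d (s≤s (s≤s z≤n)))
  survival-bound N (suc K) d@(suc (suc _)) _ d≤N = survival-bound-step N K d (s≤s (s≤s z≤n)) d≤N
    (λ e f ef≡d → survival-bound N K e (ℕ.>-nonZero⁻¹ e {{nonZero-factorˡ e f ef≡d}})
                    (ℕ.≤-trans (∣⇒≤ (divides f (trans (sym ef≡d) (ℕ.*-comm e f)))) d≤N))
    where open import Data.Nat.Divisibility using (divides; ∣⇒≤)

  cumProb⟶1 : ∀ d → 1 ℕ.≤ d → cumProb d ⟶ 1ℚ
  cumProb⟶1 d 1≤d ε 0<ε with archimedean ε 0<ε
  ... | A , 1≤εA = d ℕ.* A , close
    where
    open ≤-Reasoning
    instance _ = positive 0<ε
    close : ∀ K → d ℕ.* A ℕ.≤ K → ∣ cumProb d K - 1ℚ ∣ < ε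
    close K dA≤K = begin-strict
      ∣ cumProb d K - 1ℚ ∣
        ≡⟨ trans (cong ∣_∣ (solve 1 (λ c → c :- con 1ℚ := :- (con 1ℚ :- c)) refl (cumProb d K)))
                 (trans (∣-p∣≡∣p∣ Q) (0≤p⇒∣p∣≡p 0≤Q)) ⟩
      Q
        <⟨ *-cancelʳ-<-nonNeg M {{nonNegative (ℕ→ℚ-nonNeg (d ℕ.+ K))}} (≤-<-trans (proj₂ bound) d<εM) ⟩
      ε ∎
      where
      bound = survival-bound d K d 1≤d ℕ.≤-refl
      Q = 1ℚ - cumProb d K
      M = ℕ→ℚ (d ℕ.+ K)
      0≤Q : 0ℚ ≤ Q
      0≤Q = ≤-trans (≤-reflexive (sym (+-inverseʳ (cumProb d K)))) (+-monoˡ-≤ (- cumProb d K) (proj₁ bound))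
      0<εd : 0ℚ < ε * ℕ→ℚ d
      0<εd = subst (_< ε * ℕ→ℚ d) (*-zeroʳ ε) (*-monoʳ-<-pos ε (<-≤-trans (positive⁻¹ 1ℚ) (ℕ→ℚ-mono 1≤d)))
      d≤εK : ℕ→ℚ d ≤ ε * ℕ→ℚ K
      d≤εK = begin
        ℕ→ℚ d                       ≡⟨ *-identityʳ (ℕ→ℚ d) ⟨
        ℕ→ℚ d * 1ℚ                  ≤⟨ *-monoˡ-≤-nonNeg (ℕ→ℚ d) {{nonNegative (ℕ→ℚ-nonNeg d)}} 1≤εA ⟩
        ℕ→ℚ d * (ε * ℕ→ℚ A)         ≡⟨ solve 3 (λ a b c → a :* (b :* c) := b :* (a :* c)) refl (ℕ→ℚ d) ε (ℕ→ℚ A) ⟩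
        ε * (ℕ→ℚ d * ℕ→ℚ A)         ≡⟨ cong (ε *_) (ℕ→ℚ-* d A) ⟨
        ε * ℕ→ℚ (d ℕ.* A)           ≤⟨ *-monoˡ-≤-nonNeg ε {{nonNegative (<⇒≤ 0<ε)}} (ℕ→ℚ-mono dA≤K) ⟩
        ε * ℕ→ℚ K                   ∎
      d<εM : ℕ→ℚ d < ε * M
      d<εM = begin-strict
        ℕ→ℚ d                       ≡⟨ +-identityˡ (ℕ→ℚ d) ⟨
        0ℚ + ℕ→ℚ d                  <⟨ +-mono-<-≤ 0<εd d≤εK ⟩
        ε * ℕ→ℚ d + ε * ℕ→ℚ K       ≡⟨ trans (cong (ε *_) (ℕ→ℚ-+ d K)) (*-distribˡ-+ ε (ℕ→ℚ d) (ℕ→ℚ K)) ⟨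
        ε * M                       ∎

module UnfoldDivisorSum where

  open import Defs using (divisorSum)
  open Probabilities using (Σ<; Σ<-cong; Σ<-snoc; Σ∣; onDivisor; when)
  open import Data.Bool using (Bool; true; false; _∧_; if_then_else_)
  import Data.Nat as ℕ
  open import Data.Nat using (ℕ; zero; suc)
  open import Data.Nat.Divisibility using (_∣_; _∣?_)
  open import Data.Rational using (ℚ; _+_; 0ℚ)
  import Data.Rational.Properties as ℚ
  open import Function using (_∋_)
  open import Relation.Nullary using (Dec; yes; no)
  open import Relation.Nullary.Decidable using (⌊_⌋)
  open import Relation.Binary.PropositionalEquality
  open ≡-Reasoning

  -- The loop of divisorSum is local to its definition; this unification problem names it.
  private
    data Solution {A : Set} (x : A) : Set where
      solution : Solution x

    divisorSum-unfolds : (P : ℕ → Bool) (f : ℕ → ℕ → ℚ) →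
      let loop = (ℕ → ℕ → ℚ) ∋ _ in Solution loop → ∀ m →
      divisorSum (suc m) P f ≡ (if ⌊ suc m ∣? suc m ⌋ ∧ P (suc m)
                                  then f (suc m) (suc m ℕ./ suc m) + loop (suc m) m else loop (suc m) m)
    divisorSum-unfolds P f _ m with ⌊ suc m ∣? suc m ⌋
    ... | _ with suc m
    ...   | _ = refl

    solved : ∀ {A B : Set} {x : A} → (Solution x → B) → A
    solved {x = x} _ = x

    divisorSum-loop : (ℕ → Bool) → (ℕ → ℕ → ℚ) → ℕ → ℕ → ℚ
    divisorSum-loop P f = solved (divisorSum-unfolds P f)

  summand : (ℕ → Bool) → (ℕ → ℕ → ℚ) → ℕ → ℕ → ℚ
  summand P f n i = if ⌊ suc i ∣? n ⌋ ∧ P (suc i) then f (suc i) (n ℕ./ suc i) else 0ℚ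

  if-+ : ∀ c x y → (if c then x + y else y) ≡ (if c then x else 0ℚ) + y
  if-+ true  x y = refl
  if-+ false x y = sym (ℚ.+-identityˡ y)

  divisorSum-loop-Σ< : ∀ P f n k → divisorSum-loop P f n k ≡ Σ< k (summand P f n)
  divisorSum-loop-Σ< P f n zero    = refl
  divisorSum-loop-Σ< P f n (suc k) = begin
    divisorSum-loop P f n (suc k)                 ≡⟨ if-+ (⌊ suc k ∣? n ⌋ ∧ P (suc k)) _ _ ⟩
    summand P f n k + divisorSum-loop P f n k     ≡⟨ cong (summand P f n k +_) (divisorSum-loop-Σ< P f n k) ⟩
    summand P f n k + Σ< k (summand P f n)        ≡⟨ ℚ.+-comm (summand P f n k) _ ⟩
    Σ< k (summand P f n) + summand P f n k        ≡⟨ Σ<-snoc k (summand P f n) ⟨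
    Σ< (suc k) (summand P f n)                    ∎

  divisorSum≡Σ∣ : ∀ n .{{_ : ℕ.NonZero n}} P f → divisorSum n P f ≡ Σ∣ n (λ d e → when (P d) (f d e))
  divisorSum≡Σ∣ n@(suc m) P f = begin
    divisorSum n P f                              ≡⟨ trans (divisorSum-unfolds P f solution m) (if-+ (⌊ n ∣? n ⌋ ∧ P n) _ _) ⟩
    summand P f n m + divisorSum-loop P f n m     ≡⟨ cong (summand P f n m +_) (divisorSum-loop-Σ< P f n m) ⟩
    summand P f n m + Σ< m (summand P f n)        ≡⟨ ℚ.+-comm (summand P f n m) _ ⟩
    Σ< m (summand P f n) + summand P f n m        ≡⟨ Σ<-snoc m (summand P f n) ⟨
    Σ< n (summand P f n)                          ≡⟨ Σ<-cong n (λ i _ → at-divisor (suc i ∣? n)) ⟩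
    Σ∣ n (λ d e → when (P d) (f d e))             ∎
    where
    at-divisor : ∀ {i} (i? : Dec (suc i ∣ n)) →
                 (if ⌊ i? ⌋ ∧ P (suc i) then f (suc i) (n ℕ./ suc i) else 0ℚ) ≡ onDivisor n i i? (λ d e → when (P d) (f d e))
    at-divisor (yes _) = refl
    at-divisor (no  _) = refl

module Expectation where

  open import Defs using (IsExpectedHittingTime; φ; ℕ→ℚ)
  open DivisorSums using (nonZero-factorˡ)
  open Limits
  open Probabilities
  open Absorption using (cumProb⟶1)
  import Data.Nat as ℕ
  open import Data.Nat using (ℕ; zero; suc; s≤s; z≤n)
  import Data.Nat.Properties as ℕ
  open import Data.Nat.Divisibility using (_∣_; _∣?_)
  open import Data.Nat.DivMod using (m*[n/m]≡n)
  open import Data.Rational using (ℚ; _+_; _*_; 0ℚ; 1ℚ)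
  open import Relation.Nullary using (Dec; yes; no)
  open import Relation.Binary.PropositionalEquality

  ⟶-Σ< : ∀ n {s : ℕ → ℕ → ℚ} {L} → (∀ i → i ℕ.< n → s i ⟶ L i) → (λ K → Σ< n (λ i → s i K)) ⟶ Σ< n L
  ⟶-Σ< zero    _        = ⟶-const 0ℚ
  ⟶-Σ< (suc n) {s} conv = ⟶-+ {s 0} {λ K → Σ< n (λ i → s (suc i) K)} (conv 0 (s≤s z≤n))
                                (⟶-Σ< n (λ i i<n → conv (suc i) (s≤s i<n)))

  ⟶-Σφ : ∀ n {s : ℕ → ℕ → ℚ} {L} → (∀ d e → d ℕ.* e ≡ n → s d ⟶ L d) →
         (λ K → Σφ n (λ d → s d K)) ⟶ Σφ n L
  ⟶-Σφ n {s} {L} conv = ⟶-Σ< n (λ i _ → term (suc i ∣? n))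
    where
    term : ∀ {i} (i? : Dec (suc i ∣ n)) →
           (λ K → onDivisor n i i? (λ d _ → ℕ→ℚ (φ d) * s d K)) ⟶ onDivisor n i i? (λ d _ → ℕ→ℚ (φ d) * L d)
    term {i} (yes i+1∣n) = ⟶-*ℕ (φ (suc i)) (conv (suc i) _ (m*[n/m]≡n i+1∣n))
    term     (no  _)     = ⟶-const 0ℚ

  module _ (a : ℕ → ℚ) (hyp : ∀ m → IsExpectedHittingTime (suc m) (a (suc m))) where

    partialExp⟶ : ∀ d → 1 ℕ.≤ d → partialExp d ⟶ a d
    partialExp⟶ (suc m) _ = hyp m

    -- Let K → ∞ in partialExp-rec; the cumulative probabilities tend to 1.
    expectation-recurrence : ∀ n → 1 ℕ.< n → ℕ→ℚ n * a n ≡ Σφ n (λ d → a d + 1ℚ)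
    expectation-recurrence n 1<n = ⟶-unique {λ K → ℕ→ℚ n * partialExp n (suc K)}
      (⟶-*ℕ n (⟶-shift {partialExp n} (partialExp⟶ n (ℕ.<⇒≤ 1<n))))
      (⟶-cong (λ K → sym (partialExp-rec n 1<n K))
        (⟶-Σφ n (λ d e de≡n → let 1≤d = ℕ.>-nonZero⁻¹ d {{nonZero-factorˡ d e de≡n}} in
                                ⟶-+ {partialExp d} {cumProb d} (partialExp⟶ d 1≤d) (cumProb⟶1 d 1≤d))))
      where instance _ = ℕ.>-nonZero (ℕ.<-trans ℕ.z<s 1<n)

open import Defs
open NatToRat using (ℕ→ℚ-∸)
open Probabilities using (Σ∣; Σφ; when; Σφ-+; Σφ-1; Σ∣-involution; Σ∣-remove)
open UnfoldDivisorSum using (divisorSum≡Σ∣)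
open Expectation using (expectation-recurrence)
open Totient using (φ-≤)
open import Data.Bool using (not)
import Data.Nat as ℕ
open import Data.Nat using (ℕ; suc; _<_; _∸_; _≡ᵇ_)
import Data.Nat.Properties as ℕ
open import Data.Product using (_×_; _,_)
open import Data.Rational using (ℚ; _+_; _*_; _-_; 1ℚ)
open import Data.Rational.Solver using (module +-*-Solver)
open import Relation.Binary.PropositionalEquality

theorem2p2 : (a : ℕ → ℚ)
    → (∀ m → IsExpectedHittingTime (suc m) (a (suc m)))
    → ∀ n → 1 < n
    → (a n * ℕ→ℚ (n ∸ φ n)
         ≡ ℕ→ℚ n + divisorSum n (λ d → not (d ≡ᵇ 1))
                     (λ d n/d → ℕ→ℚ (φ n/d) * a n/d))
      × (a n * ℕ→ℚ (n ∸ φ n)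
         ≡ ℕ→ℚ n + divisorSum n (λ d → not (d ≡ᵇ n))
                     (λ d n/d → ℕ→ℚ (φ d) * a d))
theorem2p2 a hyp n 1<n = isolate split-off-1 , isolate split-off-n
  where
  open ≡-Reasoning
  open +-*-Solver
  instance _ = ℕ.>-nonZero (ℕ.<-trans ℕ.z<s 1<n)
  isolate : ∀ {R} → Σφ n a ≡ ℕ→ℚ (φ n) * a n + R → a n * ℕ→ℚ (n ∸ φ n) ≡ ℕ→ℚ n + R
  isolate {R} Σφ≡ = begin
    a n * ℕ→ℚ (n ∸ φ n)
      ≡⟨ cong (a n *_) (ℕ→ℚ-∸ (φ-≤ n)) ⟩
    a n * (ℕ→ℚ n - ℕ→ℚ (φ n))
      ≡⟨ solve 3 (λ x m p → x :* (m :- p) := m :* x :- p :* x) refl (a n) (ℕ→ℚ n) (ℕ→ℚ (φ n)) ⟩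
    ℕ→ℚ n * a n - ℕ→ℚ (φ n) * a n
      ≡⟨ cong (_- ℕ→ℚ (φ n) * a n) (expectation-recurrence a hyp n 1<n) ⟩
    Σφ n (λ d → a d + 1ℚ) - ℕ→ℚ (φ n) * a n
      ≡⟨ cong (_- ℕ→ℚ (φ n) * a n) (trans (Σφ-+ n a (λ _ → 1ℚ)) (cong₂ _+_ Σφ≡ (Σφ-1 n))) ⟩
    (ℕ→ℚ (φ n) * a n + R + ℕ→ℚ n) - ℕ→ℚ (φ n) * a n
      ≡⟨ solve 3 (λ p r m → (p :+ r :+ m) :- p := m :+ r) refl (ℕ→ℚ (φ n) * a n) R (ℕ→ℚ n) ⟩
    ℕ→ℚ n + R ∎
  split-off-1 : Σφ n a ≡ ℕ→ℚ (φ n) * a n + divisorSum n (λ d → not (d ≡ᵇ 1)) (λ d n/d → ℕ→ℚ (φ n/d) * a n/d)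
  split-off-1 = begin
    Σφ n a
      ≡⟨ Σ∣-involution n (λ d _ → ℕ→ℚ (φ d) * a d) ⟨
    Σ∣ n (λ _ e → ℕ→ℚ (φ e) * a e)
      ≡⟨ Σ∣-remove n 1 n _ (ℕ.*-identityˡ n) ⟩
    ℕ→ℚ (φ n) * a n + Σ∣ n (λ d e → when (not (d ≡ᵇ 1)) (ℕ→ℚ (φ e) * a e))
      ≡⟨ cong (ℕ→ℚ (φ n) * a n +_) (divisorSum≡Σ∣ n _ _) ⟨
    ℕ→ℚ (φ n) * a n + divisorSum n (λ d → not (d ≡ᵇ 1)) (λ d n/d → ℕ→ℚ (φ n/d) * a n/d) ∎
  split-off-n : Σφ n a ≡ ℕ→ℚ (φ n) * a n + divisorSum n (λ d → not (d ≡ᵇ n)) (λ d n/d → ℕ→ℚ (φ d) * a d)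
  split-off-n = trans (Σ∣-remove n n 1 _ (ℕ.*-identityʳ n))
                      (cong (ℕ→ℚ (φ n) * a n +_) (sym (divisorSum≡Σ∣ n _ _)))
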